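{- There is a polynomial $p$ such that every normal form $\mathrm{F}_1[\mathrm{succ},<]$ formula $\varphi$ that is satisfiable over a finite word has a model (a finite word) with at most $2^{p(|\varphi|)}$ elements.
   Context: A (finite) word is a finite structure over $\sigma_0\cup\{\mathrm{succ},<\}$, $\sigma_0$ a finite set of unary relation symbols, $<$ a strict linear order and $\mathrm{succ}$ its induced successor. $\mathrm{F}_1$ (one-dimensional fragment) is the smallest set of first-order formulas containing atoms and equalities, closed under $\vee,\neg$, and such that if $\varphi$ has free variables among $x_0,\dots,x_k$ then $\exists x_0\dots x_k\varphi$ and $\exists x_1\dots x_k\varphi$ are in it. A formula is in normal form if it has the shape $\bigwedge_{1\le i\le m_\exists}\forall y_0\exists y_1\dots y_{k_i}\varphi^\exists_i\wedge\bigwedge_{1\le i\le m_\forall}\forall x_1\dots x_{l_i}\varphi^\forall_i$ with all $\varphi^\exists_i(y_0,\dots,y_{k_i})$ and $\varphi^\forall_i(x_1,\dots,x_{l_i})$ quantifier-free. $|\varphi|$ denotes the length (number of symbols) of $\varphi$. -}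

module Defs where

open import Data.Nat using (ℕ; zero; suc; _+_; _*_; _^_; _≤_; _<_)
open import Data.Fin using (Fin; toℕ)
open import Data.Bool using (Bool; true)
open import Data.List using (List; []; _∷_; map)
open import Data.Vec.Functional using () renaming (_∷_ to _∷ᶠ_)
open import Data.Product using (Σ; _×_; _,_)
open import Data.Sum using (_⊎_)
open import Data.Unit using (⊤)
open import Relation.Nullary using (¬_)
open import Relation.Binary.PropositionalEquality using (_≡_)

-- First-order formulas over σ = σ₀ ∪ {succ, <}, where σ₀ = Fin s is a
-- finite set of unary relation symbols.  Variables are de Bruijn
-- indices: a  Formula s n  has its free variables among Fin n.

data Formula (s : ℕ) : ℕ → Set where
  ⊤'    : ∀ {n} → Formula s n
  rel   : ∀ {n} → Fin s → Fin n → Formula s n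
  succ' : ∀ {n} → Fin n → Fin n → Formula s n
  lt    : ∀ {n} → Fin n → Fin n → Formula s n
  eq    : ∀ {n} → Fin n → Fin n → Formula s n
  ¬'_   : ∀ {n} → Formula s n → Formula s n
  _∧'_  : ∀ {n} → Formula s n → Formula s n → Formula s n
  _∨'_  : ∀ {n} → Formula s n → Formula s n → Formula s n
  ∃'    : ∀ {n} → Formula s (suc n) → Formula s n      -- binds variable 0
  ∀'    : ∀ {n} → Formula s (suc n) → Formula s n      -- binds variable 0

data QF {s : ℕ} : ∀ {n} → Formula s n → Set where
  ⊤'    : ∀ {n} → QF (⊤' {s} {n})
  rel   : ∀ {n} P (x : Fin n) → QF (rel P x)
  succ' : ∀ {n} (x y : Fin n) → QF (succ' {s} x y)
  lt    : ∀ {n} (x y : Fin n) → QF (lt {s} x y)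
  eq    : ∀ {n} (x y : Fin n) → QF (eq {s} x y)
  ¬'_   : ∀ {n} {φ : Formula s n} → QF φ → QF (¬' φ)
  _∧'_  : ∀ {n} {φ ψ : Formula s n} → QF φ → QF ψ → QF (φ ∧' ψ)
  _∨'_  : ∀ {n} {φ ψ : Formula s n} → QF φ → QF ψ → QF (φ ∨' ψ)

len : ∀ {s n} → Formula s n → ℕ
len ⊤'          = 1
len (rel _ _)   = 2
len (succ' _ _) = 3
len (lt _ _)    = 3
len (eq _ _)    = 3
len (¬' φ)      = 1 + len φ
len (φ ∧' ψ)    = 1 + len φ + len ψ
len (φ ∨' ψ)    = 1 + len φ + len ψ
len (∃' φ)      = 2 + len φ
len (∀' φ)      = 2 + len φ

∃s : ∀ {s n} (k : ℕ) → Formula s (k + n) → Formula s n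
∃s zero    φ = φ
∃s (suc k) φ = ∃s k (∃' φ)

∀s : ∀ {s n} (k : ℕ) → Formula s (k + n) → Formula s n
∀s zero    φ = φ
∀s (suc k) φ = ∀s k (∀' φ)

⋀ : ∀ {s n} → List (Formula s n) → Formula s n
⋀ []       = ⊤'
⋀ (φ ∷ []) = φ
⋀ (φ ∷ φs) = φ ∧' ⋀ φs

-- Normal form:
--   ⋀_{i ≤ m∃} ∀y₀ ∃y₁…y_{kᵢ} φᵢ^∃  ∧  ⋀_{i ≤ m∀} ∀x₁…x_{lᵢ} φᵢ^∀
-- with all φᵢ^∃ (free vars y₀…y_{kᵢ}) and φᵢ^∀ (free vars x₁…x_{lᵢ})
-- quantifier-free.

ExConj : ℕ → Set
ExConj s = Σ ℕ λ k → Σ (Formula s (k + 1)) QF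

AllConj : ℕ → Set
AllConj s = Σ ℕ λ l → Σ (Formula s (l + 0)) QF

exConj : ∀ {s} → ExConj s → Formula s 0
exConj (k , (φ , _)) = ∀' (∃s k φ)

allConj : ∀ {s} → AllConj s → Formula s 0
allConj (l , (φ , _)) = ∀s l φ

record NormalForm (s : ℕ) : Set where
  constructor nf
  field
    exParts  : List (ExConj s)
    allParts : List (AllConj s)

⌜_⌝ : ∀ {s} → NormalForm s → Formula s 0
⌜ nf es as ⌝ = ⋀ (map exConj es) ∧' ⋀ (map allConj as)

-- Finite words over σ₀ = Fin s: domain {0,…,size-1} (nonempty), the
-- order < and successor are the natural ones on positions, and each unary
-- symbol P is interpreted by the set of positions i with label i P ≡ true.

record Word (s : ℕ) : Set where
  field
    size     : ℕ
    nonempty : 1 ≤ size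
    label    : Fin size → Fin s → Bool
open Word public

-- satisfaction  w , ρ ⊨ φ   (all quantifiers range over the finite domain,
-- atoms are decidable, so this agrees with the classical semantics)
Sat : ∀ {s n} (w : Word s) → (Fin n → Fin (size w)) → Formula s n → Set
Sat w ρ ⊤'          = ⊤
Sat w ρ (rel P x)   = label w (ρ x) P ≡ true
Sat w ρ (succ' x y) = toℕ (ρ y) ≡ suc (toℕ (ρ x))
Sat w ρ (lt x y)    = toℕ (ρ x) < toℕ (ρ y)
Sat w ρ (eq x y)    = ρ x ≡ ρ y
Sat w ρ (¬' φ)      = ¬ Sat w ρ φ
Sat w ρ (φ ∧' ψ)    = Sat w ρ φ × Sat w ρ ψ
Sat w ρ (φ ∨' ψ)    = Sat w ρ φ ⊎ Sat w ρ ψ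
Sat w ρ (∃' φ)      = Σ (Fin (size w)) λ a → Sat w (a ∷ᶠ ρ) φ
Sat w ρ (∀' φ)      = (a : Fin (size w)) → Sat w (a ∷ᶠ ρ) φ

_⊨_ : ∀ {s} → Word s → Formula s 0 → Set
w ⊨ φ = Sat w (λ ()) φ

-- Polynomials with natural-number coefficients (constant term first).

Poly : Set
Poly = List ℕ

eval : Poly → ℕ → ℕ
eval []       x = 0
eval (c ∷ cs) x = c + x * eval cs x

{-# OPTIONS --safe #-}
-- With V = |φ| variables, the type of a partial V-tuple of positions records,
-- for each pair of its variables, their order, successor and equality
-- relations and the letters (over the predicates of φ) at them.  The number of
-- types realised left of a point c grows with c, and so does the number of
-- types not realised right of c; both are bounded by the number M of types, so
-- among 2M + 1 consecutive blocks one block [c, c′) changes neither.  Inside it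
-- two positions b₁ < b₂ start equal windows of length 2V + 2, and cutting out
-- [b₁ + V + 1, b₂ + V + 1) gives a shorter word w′ in which every tuple has a
-- tuple of w of the same type, and every tuple of w with a prescribed variable
-- in w′ has a tuple of w′ of the same type keeping that variable.  (The part
-- of a tuple near the cut is moved from one window to the other around a
-- window position the tuple misses.)  So the ∀- and ∀∃-conjuncts of a normal
-- form pass from w to w′, and iterating the cut yields a model of size below
-- 2 ^ p(|φ|).

module Submission where

open import Defs
open import Data.Bool using (Bool; true; false)
open import Data.Bool.Properties using () renaming (_≟_ to _≟ᵇ_)
open import Data.Empty using (⊥-elim)
open import Data.Fin using (Fin; toℕ; fromℕ<; inject≤; _↑ʳ_) renaming (_<_ to _<ᶠ_)
import Data.Fin.Properties as Fin
open import Data.List using (List; []; _∷_; map; _++_; length; upTo)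
open import Data.List.Properties using (length-++; length-map)
open import Data.List.Membership.Propositional using (_∈_; lose)
open import Data.List.Membership.Propositional.Properties using (∈-map⁺; ∈-++⁺ˡ; ∈-++⁺ʳ; ∈-upTo⁺)
open import Data.List.Membership.Setoid.Properties using (index-injective)
open import Data.List.Relation.Binary.Subset.Propositional using (_⊆_)
open import Data.List.Relation.Unary.All as All using (All; []; _∷_)
open import Data.List.Relation.Unary.Any as Any using (Any; here; there; any?)
open import Data.Maybe using (Maybe; just; nothing)
import Data.Maybe as Maybe
open import Data.Maybe.Properties using (just-injective) renaming (≡-dec to ≡-decᵐ)
open import Data.Nat using (ℕ; zero; suc; _+_; _*_; _∸_; _^_; _≤_; _<_; z≤n; s≤s; _≤?_; _<?_; s≤s⁻¹)
open import Data.Nat.Induction using (<-wellFounded)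
open import Data.Nat.Properties
open import Data.Nat.Tactic.RingSolver using (solve-∀)
open import Data.Product using (Σ; _×_; _,_; proj₁; proj₂)
open import Data.Product.Function.NonDependent.Propositional using (_×-⇔_)
open import Data.Sum using (_⊎_; inj₁; inj₂)
open import Data.Sum.Function.Propositional using (_⊎-⇔_)
open import Data.Unit using (⊤; tt)
open import Data.Vec using (Vec; []; _∷_; replicate; lookup; tabulate)
import Data.Vec.Properties as Vec
open import Data.Vec.Functional using () renaming (_∷_ to _∷ᶠ_)
open import Function using (_∘_; id)
open import Function.Bundles using (_⇔_; mk⇔; Equivalence)
open import Function.Properties.Equivalence using () renaming (refl to ⇔-refl; sym to ⇔-sym; trans to ⇔-trans)
open import Induction.WellFounded using (Acc; acc)
open import Relation.Binary.Definitions using (tri<; tri≈; tri>)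
open import Relation.Binary.PropositionalEquality using (_≡_; _≢_; refl; sym; trans; cong; cong₂; subst; subst₂; setoid; module ≡-Reasoning)
open import Relation.Nullary using (¬_; Dec; yes; no; does; contradiction)
open import Relation.Nullary.Decidable using (_×-dec_; ¬?)

open Equivalence using (to; from)

does-cong : ∀ {A B : Set} (a? : Dec A) (b? : Dec B) → A ⇔ B → does a? ≡ does b?
does-cong (yes _) (yes _) _   = refl
does-cong (yes a) (no ¬b) a⇔b = contradiction (to a⇔b a) ¬b
does-cong (no ¬a) (yes b) a⇔b = contradiction (from a⇔b b) ¬a
does-cong (no _)  (no _)  _   = refl

does-injective : ∀ {A B : Set} (a? : Dec A) (b? : Dec B) → does a? ≡ does b? → A ⇔ B
does-injective (yes a) (yes b) _ = mk⇔ (λ _ → b) (λ _ → a)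
does-injective (no ¬a) (no ¬b) _ = mk⇔ (λ a → contradiction a ¬a) (λ b → contradiction b ¬b)

¬⇔¬ : ∀ {A B : Set} → ¬ A → ¬ B → A ⇔ B
¬⇔¬ ¬a ¬b = mk⇔ (⊥-elim ∘ ¬a) (⊥-elim ∘ ¬b)

SameRel : ℕ → ℕ → ℕ → ℕ → Set
SameRel p q p′ q′ = (p < q ⇔ p′ < q′) × (suc p ≡ q ⇔ suc p′ ≡ q′) × (p ≡ q ⇔ p′ ≡ q′)

SameRel-sym : ∀ {p q p′ q′} → SameRel p q p′ q′ → SameRel p′ q′ p q
SameRel-sym (a , b , c) = ⇔-sym a , ⇔-sym b , ⇔-sym c

SameRel-trans : ∀ {p q p′ q′ p″ q″} → SameRel p q p′ q′ → SameRel p′ q′ p″ q″ → SameRel p q p″ q″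
SameRel-trans (a , b , c) (a′ , b′ , c′) = ⇔-trans a a′ , ⇔-trans b b′ , ⇔-trans c c′

SameRel-+ˡ : ∀ k p q → SameRel p q (k + p) (k + q)
SameRel-+ˡ k p q =
  mk⇔ (+-monoʳ-< k) (+-cancelˡ-< k p q) ,
  mk⇔ (λ e → trans (sym (+-suc k p)) (cong (k +_) e)) (λ e → +-cancelˡ-≡ k (suc p) q (trans (+-suc k p) e)) ,
  mk⇔ (cong (k +_)) (+-cancelˡ-≡ k p q)

SameRel-+ʳ : ∀ k p q → SameRel p q (p + k) (q + k)
SameRel-+ʳ k p q rewrite +-comm p k | +-comm q k = SameRel-+ˡ k p q

SameRel-translate : ∀ b b′ u v → SameRel (b + u) (b + v) (b′ + u) (b′ + v)
SameRel-translate b b′ u v = SameRel-trans (SameRel-sym (SameRel-+ˡ b u v)) (SameRel-+ˡ b′ u v)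

pairType : ∀ {t} → (ℕ → Vec Bool t) → Maybe ℕ → Maybe ℕ → Vec Bool (5 + t)
pairType lab nothing  _        = replicate _ false
pairType lab (just p) nothing  = true ∷ false ∷ false ∷ false ∷ false ∷ lab p
pairType lab (just p) (just q) = true ∷ true ∷ does (p <? q) ∷ does (suc p ≟ q) ∷ does (p ≟ q) ∷ lab p

module _ {t} (lab lab′ : ℕ → Vec Bool t) where

  pairType-cong : ∀ {p q p′ q′} → lab p ≡ lab′ p′ → SameRel p q p′ q′ →
                  pairType lab (just p) (just q) ≡ pairType lab′ (just p′) (just q′)
  pairType-cong {p} {q} {p′} {q′} ℓ≡ (<⇔ , succ⇔ , ≡⇔)
    rewrite ℓ≡ | does-cong (p <? q) (p′ <? q′) <⇔ | does-cong (suc p ≟ q) (suc p′ ≟ q′) succ⇔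
            | does-cong (p ≟ q) (p′ ≟ q′) ≡⇔ = refl

  pairType-injective : ∀ {p q p′ q′} → pairType lab (just p) (just q) ≡ pairType lab′ (just p′) (just q′) →
                       lab p ≡ lab′ p′ × SameRel p q p′ q′
  pairType-injective {p} {q} {p′} {q′} e
    with _ , e₁ ← Vec.∷-injective e
    with _ , e₂ ← Vec.∷-injective e₁
    with <b , e₃ ← Vec.∷-injective e₂
    with succb , e₄ ← Vec.∷-injective e₃
    with ≡b , ℓ≡ ← Vec.∷-injective e₄ =
    ℓ≡ , does-injective (p <? q) (p′ <? q′) <b , does-injective (suc p ≟ q) (suc p′ ≟ q′) succb ,
    does-injective (p ≟ q) (p′ ≟ q′) ≡b

  pairType-diag⇒label : ∀ {p p′} → pairType lab (just p) (just p) ≡ pairType lab′ (just p′) (just p′) → lab p ≡ lab′ p′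
  pairType-diag⇒label = proj₁ ∘ pairType-injective

  pairType-diag⇒just : ∀ {a p} → pairType lab (just p) (just p) ≡ pairType lab′ a a → Σ ℕ λ q → a ≡ just q
  pairType-diag⇒just {just q} _ = q , refl

  pairType-single : ∀ {p p′} → lab p ≡ lab′ p′ → pairType lab (just p) nothing ≡ pairType lab′ (just p′) nothing
  pairType-single ℓ≡ rewrite ℓ≡ = refl

  pairType-label : ∀ {p} a → lab p ≡ lab′ p → pairType lab (just p) a ≡ pairType lab′ (just p) a
  pairType-label nothing  ℓ≡ rewrite ℓ≡ = refl
  pairType-label (just q) ℓ≡ rewrite ℓ≡ = refl

  pairType-<-cong : ∀ {p P q Q} → p < P → q < Q → (suc p ≡ P ⇔ suc q ≡ Q) → lab p ≡ lab′ q →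
                    pairType lab (just p) (just P) ≡ pairType lab′ (just q) (just Q)
  pairType-<-cong p<P q<Q adj ℓ≡ =
    pairType-cong ℓ≡ (mk⇔ (λ _ → q<Q) (λ _ → p<P) , adj , ¬⇔¬ (<⇒≢ p<P) (<⇒≢ q<Q))

  pairType->-cong : ∀ {p P q Q} → p < P → q < Q → lab P ≡ lab′ Q →
                    pairType lab (just P) (just p) ≡ pairType lab′ (just Q) (just q)
  pairType->-cong p<P q<Q ℓ≡ =
    pairType-cong ℓ≡ (¬⇔¬ (<-asym p<P) (<-asym q<Q) ,
                      ¬⇔¬ (λ e → <-asym p<P (subst (_ <_) e (n<1+n _))) (λ e → <-asym q<Q (subst (_ <_) e (n<1+n _))) ,
                      ¬⇔¬ (<⇒≢ p<P ∘ sym) (<⇒≢ q<Q ∘ sym))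

suc≡⇔-across : ∀ {p c P} → p < c → c ≤ P → (suc p ≡ P) ⇔ (suc p ≡ c × P ≡ c)
suc≡⇔-across p<c c≤P =
  mk⇔ (λ e → ≤-antisym p<c (subst (_ ≤_) (sym e) c≤P) , ≤-antisym (subst (_≤ _) e p<c) c≤P)
      (λ (e₁ , e₂) → trans e₁ (sym e₂))

module _ {t} (lab lab′ : ℕ → Vec Bool t) where

  pairType-<-across : ∀ {p P q Q c c′} → p < c → c ≤ P → q < c′ → c′ ≤ Q → lab p ≡ lab′ q →
                      (suc p ≡ c ⇔ suc q ≡ c′) → (P ≡ c ⇔ Q ≡ c′) →
                      pairType lab (just p) (just P) ≡ pairType lab′ (just q) (just Q)
  pairType-<-across p<c c≤P q<c′ c′≤Q ℓ≡ ≡c ≡c′ =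
    pairType-<-cong lab lab′ (<-≤-trans p<c c≤P) (<-≤-trans q<c′ c′≤Q)
      (⇔-trans (suc≡⇔-across p<c c≤P) (⇔-trans (≡c ×-⇔ ≡c′) (⇔-sym (suc≡⇔-across q<c′ c′≤Q)))) ℓ≡

pairType-≡ : ∀ {t} {lab lab′ : ℕ → Vec Bool t} {a b c d a′ b′ c′ d′} → a ≡ a′ → b ≡ b′ → c ≡ c′ → d ≡ d′ →
             pairType lab a′ b′ ≡ pairType lab′ c′ d′ → pairType lab a b ≡ pairType lab′ c d
pairType-≡ refl refl refl refl e = e

suc≢-beyond : ∀ {p c d} → p < c → c < d → suc p ≢ d
suc≢-beyond p<c c<d refl = <-irrefl refl (<-≤-trans c<d p<c)

prependAll : ∀ {A : Set} {k} → List A → List (Vec A k) → List (Vec A (suc k))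
prependAll []       vs = []
prependAll (a ∷ as) vs = map (a ∷_) vs ++ prependAll as vs

vectors : ∀ {A : Set} → List A → (k : ℕ) → List (Vec A k)
vectors as zero    = [] ∷ []
vectors as (suc k) = prependAll as (vectors as k)

∈-prependAll : ∀ {A : Set} {k} {a : A} {v : Vec A k} as vs → a ∈ as → v ∈ vs → (a ∷ v) ∈ prependAll as vs
∈-prependAll (a ∷ as) vs (here refl) v∈ = ∈-++⁺ˡ (∈-map⁺ (a ∷_) v∈)
∈-prependAll (a ∷ as) vs (there a∈) v∈ = ∈-++⁺ʳ (map (a ∷_) vs) (∈-prependAll as vs a∈ v∈)

∈-vectors : ∀ {A : Set} (as : List A) {k} (v : Vec A k) → (∀ i → lookup v i ∈ as) → v ∈ vectors as k
∈-vectors as []      _   = here refl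
∈-vectors as (a ∷ v) ∈as = ∈-prependAll as _ (∈as Fin.zero) (∈-vectors as v (∈as ∘ Fin.suc))

length-prependAll : ∀ {A : Set} {k} (as : List A) (vs : List (Vec A k)) → length (prependAll as vs) ≡ length as * length vs
length-prependAll []       vs = refl
length-prependAll (a ∷ as) vs =
  trans (length-++ (map (a ∷_) vs)) (cong₂ _+_ (length-map (a ∷_) vs) (length-prependAll as vs))

length-vectors : ∀ {A : Set} (as : List A) k → length (vectors as k) ≡ length as ^ k
length-vectors as zero = refl
length-vectors as (suc k) rewrite length-prependAll as (vectors as k) | length-vectors as k = refl

bools : List Bool
bools = true ∷ false ∷ []

∈-bools : ∀ b → b ∈ bools
∈-bools true  = here refl
∈-bools false = there (here refl)

count : ∀ {A : Set} {P : A → Set} → (∀ x → Dec (P x)) → List A → ℕ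
count P? [] = 0
count P? (x ∷ xs) with P? x
... | yes _ = suc (count P? xs)
... | no _  = count P? xs

count≤length : ∀ {A : Set} {P : A → Set} (P? : ∀ x → Dec (P x)) xs → count P? xs ≤ length xs
count≤length P? [] = z≤n
count≤length P? (x ∷ xs) with P? x
... | yes _ = s≤s (count≤length P? xs)
... | no _  = m≤n⇒m≤1+n (count≤length P? xs)

module _ {A : Set} {P Q : A → Set} (P? : ∀ x → Dec (P x)) (Q? : ∀ x → Dec (Q x)) (P⇒Q : ∀ x → P x → Q x) where

  count-mono : ∀ xs → count P? xs ≤ count Q? xs
  count-mono [] = z≤n
  count-mono (x ∷ xs) with P? x | Q? x
  ... | yes _  | yes _  = s≤s (count-mono xs)
  ... | yes px | no ¬qx = contradiction (P⇒Q x px) ¬qx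
  ... | no _   | yes _  = m≤n⇒m≤1+n (count-mono xs)
  ... | no _   | no _   = count-mono xs

  count-≡⇒Q⇒P : ∀ xs → count P? xs ≡ count Q? xs → ∀ {x} → x ∈ xs → Q x → P x
  count-≡⇒Q⇒P (y ∷ xs) e x∈ qx with P? y | Q? y | x∈
  ... | yes py | yes _  | here refl = py
  ... | yes _  | yes _  | there x∈′ = count-≡⇒Q⇒P xs (suc-injective e) x∈′ qx
  ... | yes py | no ¬qy | _         = contradiction (P⇒Q y py) ¬qy
  ... | no _   | yes _  | _         = contradiction e (<⇒≢ (s≤s (count-mono xs)))
  ... | no _   | no ¬qy | here refl = contradiction qx ¬qy
  ... | no _   | no _   | there x∈′ = count-≡⇒Q⇒P xs e x∈′ qx

-- A partial V-tuple of positions of a word; nothing marks an unassigned variable.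
Tuple : ℕ → Set
Tuple V = Fin V → Maybe ℕ

InRange : ℕ → ℕ → Maybe ℕ → Set
InRange lo hi nothing  = ⊤
InRange lo hi (just p) = lo ≤ p × p < hi

InRange? : ∀ lo hi m → Dec (InRange lo hi m)
InRange? lo hi nothing  = yes tt
InRange? lo hi (just p) = (lo ≤? p) ×-dec (p <? hi)

InRange-mono : ∀ {lo hi lo′ hi′} → lo′ ≤ lo → hi ≤ hi′ → ∀ m → InRange lo hi m → InRange lo′ hi′ m
InRange-mono _   _   nothing  _           = tt
InRange-mono lo′≤ ≤hi′ (just p) (lo≤ , <hi) = ≤-trans lo′≤ lo≤ , <-≤-trans <hi ≤hi′

InRange-just : ∀ {lo hi m p} → m ≡ just p → InRange lo hi m → lo ≤ p × p < hi
InRange-just refl r = r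

Within : ∀ {V} → ℕ → ℕ → Tuple V → Set
Within lo hi A = ∀ x → InRange lo hi (A x)

Within? : ∀ {V} lo hi (A : Tuple V) → Dec (Within lo hi A)
Within? lo hi A = Fin.all? (λ x → InRange? lo hi (A x))

SameType : ∀ {V t} → (ℕ → Vec Bool t) → Tuple V → (ℕ → Vec Bool t) → Tuple V → Set
SameType lab A lab′ B = ∀ x y → pairType lab (A x) (A y) ≡ pairType lab′ (B x) (B y)

record Image {V t} (lab lab′ : ℕ → Vec Bool t) (A : Tuple V) (lo hi : ℕ) : Set where
  constructor image
  field
    tuple    : Tuple V
    within   : Within lo hi tuple
    sameType : SameType lab A lab′ tuple

image-just : ∀ {V t} {lab lab′ : ℕ → Vec Bool t} {A : Tuple V} {lo hi} (I : Image lab lab′ A lo hi) →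
             ∀ {x p} → A x ≡ just p → Σ ℕ λ q → Image.tuple I x ≡ just q × (lo ≤ q × q < hi) × lab p ≡ lab′ q
image-just {lab = lab} {lab′} (image B B⊂ A~B) {x} Ax
  with q , Bx ← pairType-diag⇒just lab lab′ (pairType-≡ {c = B x} {d = B x} (sym Ax) (sym Ax) refl refl (A~B x x)) =
  q , Bx , InRange-just Bx (B⊂ x) , pairType-diag⇒label lab lab′ (pairType-≡ (sym Ax) (sym Ax) (sym Bx) (sym Bx) (A~B x x))

Types⊆ : ∀ {t} (V : ℕ) → (ℕ → Vec Bool t) → ℕ → ℕ → ℕ → ℕ → Set
Types⊆ V lab lo hi lo′ hi′ = ∀ (A : Tuple V) → Within lo hi A → Image lab lab A lo′ hi′

module _ {t} (V : ℕ) (lab : ℕ → Vec Bool t) where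

  Types⊆-mono : ∀ {lo hi lo′ hi′} → lo′ ≤ lo → hi ≤ hi′ → Types⊆ V lab lo hi lo′ hi′
  Types⊆-mono lo′≤ ≤hi′ A A⊂ = image A (λ x → InRange-mono lo′≤ ≤hi′ (A x) (A⊂ x)) (λ _ _ → refl)

  Types⊆-trans : ∀ {l₁ h₁ l₂ h₂ l₃ h₃} → Types⊆ V lab l₁ h₁ l₂ h₂ → Types⊆ V lab l₂ h₂ l₃ h₃ → Types⊆ V lab l₁ h₁ l₃ h₃
  Types⊆-trans i₁ i₂ A A⊂ with image B B⊂ A~B ← i₁ A A⊂ with image C C⊂ B~C ← i₂ B B⊂ =
    image C C⊂ λ x y → trans (A~B x y) (B~C x y)

TypeMatrix : ℕ → ℕ → Set
TypeMatrix V t = Vec (Vec (Vec Bool (5 + t)) V) V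

typeMatrix : ∀ {V t} → (ℕ → Vec Bool t) → Tuple V → TypeMatrix V t
typeMatrix lab A = tabulate λ x → tabulate λ y → pairType lab (A x) (A y)

lookup-typeMatrix : ∀ {V t} (lab : ℕ → Vec Bool t) (A : Tuple V) x y → lookup (lookup (typeMatrix lab A) x) y ≡ pairType lab (A x) (A y)
lookup-typeMatrix lab A x y = trans (cong (λ r → lookup r y) (Vec.lookup∘tabulate _ x)) (Vec.lookup∘tabulate _ y)

typeMatrix⇒SameType : ∀ {V t} (lab lab′ : ℕ → Vec Bool t) (A B : Tuple V) → typeMatrix lab A ≡ typeMatrix lab′ B → SameType lab A lab′ B
typeMatrix⇒SameType lab lab′ A B e x y =
  trans (sym (lookup-typeMatrix lab A x y)) (trans (cong (λ T → lookup (lookup T x) y) e) (lookup-typeMatrix lab′ B x y))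

SameType⇒typeMatrix : ∀ {V t} (lab lab′ : ℕ → Vec Bool t) (A B : Tuple V) → SameType lab A lab′ B → typeMatrix lab A ≡ typeMatrix lab′ B
SameType⇒typeMatrix lab lab′ A B A~B = Vec.tabulate-cong (λ x → Vec.tabulate-cong (λ y → A~B x y))

typeMatrix-dec : ∀ {V t} (τ τ′ : TypeMatrix V t) → Dec (τ ≡ τ′)
typeMatrix-dec = Vec.≡-dec (Vec.≡-dec (Vec.≡-dec _≟ᵇ_))

allTypeMatrices : ∀ V t → List (TypeMatrix V t)
allTypeMatrices V t = vectors (vectors (vectors bools (5 + t)) V) V

∈-allTypeMatrices : ∀ V t (τ : TypeMatrix V t) → τ ∈ allTypeMatrices V t
∈-allTypeMatrices V t τ = ∈-vectors _ τ (λ _ → ∈-vectors _ _ (λ _ → ∈-vectors _ _ (λ _ → ∈-bools _)))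

#typeMatrices : ℕ → ℕ → ℕ
#typeMatrices V t = ((2 ^ (5 + t)) ^ V) ^ V

length-allTypeMatrices : ∀ V t → length (allTypeMatrices V t) ≡ #typeMatrices V t
length-allTypeMatrices V t
  rewrite length-vectors (vectors (vectors bools (5 + t)) V) V | length-vectors (vectors bools (5 + t)) V
        | length-vectors bools (5 + t) = refl

module _ {t} (V : ℕ) (lab : ℕ → Vec Bool t) where

  Realised : ℕ → ℕ → TypeMatrix V t → Set
  Realised lo hi τ = Σ (Tuple V) λ A → Within lo hi A × typeMatrix lab A ≡ τ

  -- A realising tuple in [lo, hi) can be found among the vectors over
  -- nothing, just 0, …, just (hi - 1).
  candidates : ℕ → List (Vec (Maybe ℕ) V)
  candidates hi = vectors (nothing ∷ map just (upTo hi)) V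

  ∈-candidates : ∀ {lo hi} (A : Tuple V) → Within lo hi A → tabulate A ∈ candidates hi
  ∈-candidates {lo} {hi} A A⊂ = ∈-vectors _ (tabulate A) λ x → subst (_∈ _) (sym (Vec.lookup∘tabulate A x)) (∈values (A x) (A⊂ x))
    where
      ∈values : ∀ m → InRange lo hi m → m ∈ nothing ∷ map just (upTo hi)
      ∈values nothing  _          = here refl
      ∈values (just p) (_ , p<hi) = there (∈-map⁺ just (∈-upTo⁺ p<hi))

  realised? : ∀ lo hi τ → Dec (Realised lo hi τ)
  realised? lo hi τ with any? (λ v → Within? lo hi (lookup v) ×-dec typeMatrix-dec (typeMatrix lab (lookup v)) τ) (candidates hi)
  ... | yes found = yes (witness found)
    where
      witness : ∀ {vs} → Any (λ v → Within lo hi (lookup v) × typeMatrix lab (lookup v) ≡ τ) vs → Realised lo hi τ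
      witness (here (A⊂ , e)) = _ , A⊂ , e
      witness (there found)   = witness found
  ... | no none = no λ (A , A⊂ , e) →
    none (lose (∈-candidates A A⊂)
               ((λ x → subst (InRange lo hi) (sym (Vec.lookup∘tabulate A x)) (A⊂ x)) ,
                trans (SameType⇒typeMatrix lab lab (lookup (tabulate A)) A λ x y → cong₂ (pairType lab) (Vec.lookup∘tabulate A x) (Vec.lookup∘tabulate A y)) e))

  #types : ℕ → ℕ → ℕ
  #types lo hi = count (realised? lo hi) (allTypeMatrices V t)

  #types≤ : ∀ lo hi → #types lo hi ≤ #typeMatrices V t
  #types≤ lo hi = subst (#types lo hi ≤_) (length-allTypeMatrices V t) (count≤length (realised? lo hi) (allTypeMatrices V t))

  Types⊆⇒Realised⊆ : ∀ {lo hi lo′ hi′} → Types⊆ V lab lo hi lo′ hi′ → ∀ τ → Realised lo hi τ → Realised lo′ hi′ τ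
  Types⊆⇒Realised⊆ ⊆ τ (A , A⊂ , e) with image B B⊂ A~B ← ⊆ A A⊂ = B , B⊂ , trans (sym (SameType⇒typeMatrix lab lab A B A~B)) e

  #types-mono : ∀ {lo hi lo′ hi′} → lo′ ≤ lo → hi ≤ hi′ → #types lo hi ≤ #types lo′ hi′
  #types-mono lo′≤ ≤hi′ = count-mono (realised? _ _) (realised? _ _) (Types⊆⇒Realised⊆ (Types⊆-mono V lab lo′≤ ≤hi′)) (allTypeMatrices V t)

  #types-≡⇒Types⊆ : ∀ {lo hi lo′ hi′} → lo′ ≤ lo → hi ≤ hi′ → #types lo hi ≡ #types lo′ hi′ → Types⊆ V lab lo′ hi′ lo hi
  #types-≡⇒Types⊆ lo′≤ ≤hi′ e A A⊂
    with B , B⊂ , e′ ← count-≡⇒Q⇒P (realised? _ _) (realised? _ _) (Types⊆⇒Realised⊆ (Types⊆-mono V lab lo′≤ ≤hi′)) (allTypeMatrices V t) e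
                         (∈-allTypeMatrices V t (typeMatrix lab A)) (A , A⊂ , refl)
    = image B B⊂ (typeMatrix⇒SameType lab lab A B (sym e′))

module _ {P : ℕ → Set} (P? : ∀ p → Dec (P p)) (f g : ℕ → Maybe ℕ) where

  splitOn : Maybe ℕ → Maybe ℕ
  splitOn nothing = nothing
  splitOn (just p) with P? p
  ... | yes _ = f p
  ... | no _  = g p

  splitOn-yes : ∀ {p} → P p → splitOn (just p) ≡ f p
  splitOn-yes {p} Pp with P? p
  ... | yes _  = refl
  ... | no ¬Pp = contradiction Pp ¬Pp

  splitOn-no : ∀ {p} → ¬ P p → splitOn (just p) ≡ g p
  splitOn-no {p} ¬Pp with P? p
  ... | yes Pp = contradiction Pp ¬Pp
  ... | no _   = refl

  splitOn-preserves : ∀ {R R′ : Maybe ℕ → Set} → R′ nothing →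
                      (∀ {p} → P p → R (just p) → R′ (f p)) → (∀ {p} → ¬ P p → R (just p) → R′ (g p)) →
                      ∀ m → R m → R′ (splitOn m)
  splitOn-preserves R′nothing _ _ nothing _ = R′nothing
  splitOn-preserves _ yes⇒ no⇒ (just p) r with P? p
  ... | yes Pp  = yes⇒ Pp r
  ... | no ¬Pp  = no⇒ ¬Pp r

missed : ∀ {V} (A : Tuple V) (f : Fin (suc V) → ℕ) → (∀ i j → f i ≡ f j → i ≡ j) →
         Σ (Fin (suc V)) λ g → ∀ x → A x ≢ just (f g)
missed {V} A f f-inj with Fin.any? (λ g → Fin.all? (λ x → ¬? (≡-decᵐ _≟_ (A x) (just (f g)))))
... | yes found = found
... | no none = ⊥-elim (collision (Fin.pigeonhole (n<1+n V) (proj₁ ∘ occupant)))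
  where
    occupant : ∀ g → Σ (Fin V) λ x → A x ≡ just (f g)
    occupant g with Fin.¬∀⟶∃¬ V _ (λ x → ¬? (≡-decᵐ _≟_ (A x) (just (f g)))) (λ free → none (g , free))
    ... | x , occupied with ≡-decᵐ _≟_ (A x) (just (f g))
    ...   | yes e = x , e
    ...   | no ne = contradiction ne occupied
    collision : ¬ (Σ (Fin (suc V)) λ i → Σ (Fin (suc V)) λ j → i <ᶠ j × proj₁ (occupant i) ≡ proj₁ (occupant j))
    collision (i , j , i<j , e) =
      Fin.<-irrefl (f-inj i j (just-injective (trans (sym (proj₂ (occupant i))) (trans (cong A e) (proj₂ (occupant j)))))) i<j

Hits⇔ : ∀ {V} → Tuple V → ℕ → Tuple V → ℕ → Set
Hits⇔ A m B m′ = ∀ x → A x ≡ just m ⇔ B x ≡ just m′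

Hits⇔-at : ∀ {V} {A B : Tuple V} {m m′} → Hits⇔ A m B m′ → ∀ {x p q} → A x ≡ just p → B x ≡ just q → p ≡ m ⇔ q ≡ m′
Hits⇔-at hits {x} Ax Bx =
  mk⇔ (λ p≡m → just-injective (trans (sym Bx) (to (hits x) (trans Ax (cong just p≡m)))))
      (λ q≡m′ → just-injective (trans (sym Ax) (from (hits x) (trans Bx (cong just q≡m′)))))

-- Moving the window [b, b + V] to [b′, b′ + V] with the same letters: the
-- tuple misses some b + g, the part before b + g is handled by prefix⊆ g,
-- the part after it is translated.
module ShiftPrefix {t} (V : ℕ) (lab : ℕ → Vec Bool t) (b b′ : ℕ)
  (window≡ : ∀ u → u ≤ V → lab (b + u) ≡ lab (b′ + u))
  (prefix⊆ : ∀ g → g ≤ V → Types⊆ V lab 0 (b + g) 0 (b′ + g))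
  (A : Tuple V) (A⊂ : Within 0 (b + suc V) A) where

  -- Opaque: unfolding the search in missed makes the case analyses below
  -- very expensive to check.
  opaque
    gap : Σ (Fin (suc V)) λ g → ∀ x → A x ≢ just (b + toℕ g)
    gap = missed A (λ g → b + toℕ g) (λ i j e → Fin.toℕ-injective (+-cancelˡ-≡ b _ _ e))

  g : ℕ
  g = toℕ (proj₁ gap)

  g≤V : g ≤ V
  g≤V = s≤s⁻¹ (Fin.toℕ<n (proj₁ gap))

  z z′ : ℕ
  z  = b + g
  z′ = b′ + g

  beforeGap : Maybe ℕ → Maybe ℕ
  beforeGap = splitOn (_<? z) just (λ _ → nothing)

  F : Tuple V
  F x = beforeGap (A x)

  F⊂ : Within 0 z F
  F⊂ x = splitOn-preserves (_<? z) just (λ _ → nothing) {R = InRange 0 (b + suc V)} {R′ = InRange 0 z} tt (λ p<z _ → z≤n , p<z) (λ _ _ → tt) (A x) (A⊂ x)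

  F-image : Image lab lab F 0 z′
  F-image = prefix⊆ g g≤V F F⊂
  open Image F-image renaming (tuple to F′; sameType to F~F′)

  A′-at : Fin V → Maybe ℕ → Maybe ℕ
  A′-at x = splitOn (_<? z) (λ _ → F′ x) (λ p → just (b′ + (p ∸ b)))

  A′ : Tuple V
  A′ x = A′-at x (A x)

  data Position (x : Fin V) : Set where
    unset  : A x ≡ nothing → A′ x ≡ nothing → Position x
    before : ∀ p q → A x ≡ just p → p < z → A′ x ≡ just q → q < z′ → F x ≡ just p → F′ x ≡ just q → lab p ≡ lab q → Position x
    after  : ∀ u → A x ≡ just (b + u) → g < u → u ≤ V → A′ x ≡ just (b′ + u) → Position x

  position : ∀ x → Position x
  position x with A x in eA
  ... | nothing = unset eA (cong (A′-at x) eA)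
  ... | just p with p <? z
  ...   | yes p<z with Fx ← trans (cong beforeGap eA) (splitOn-yes (_<? z) just _ p<z)
                  with q , F′x , (_ , q<z′) , ℓ≡ ← image-just F-image Fx =
    before p q eA p<z (trans (trans (cong (A′-at x) eA) (splitOn-yes (_<? z) _ _ p<z)) F′x) q<z′ Fx F′x ℓ≡
  ...   | no p≮z = after (p ∸ b) (trans eA (cong just (sym b+[p∸b]≡p))) g<p∸b p∸b≤V
                         (trans (cong (A′-at x) eA) (splitOn-no (_<? z) _ _ p≮z))
    where
      z<p : z < p
      z<p with <-cmp z p
      ... | tri< z<p _ _ = z<p
      ... | tri≈ _ z≡p _ = contradiction (trans eA (cong just (sym z≡p))) (proj₂ gap x)
      ... | tri> _ _ p<z = contradiction p<z p≮z
      b+[p∸b]≡p : b + (p ∸ b) ≡ p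
      b+[p∸b]≡p = m+[n∸m]≡n (≤-trans (m≤m+n b g) (<⇒≤ z<p))
      g<p∸b : g < p ∸ b
      g<p∸b = +-cancelˡ-< b g (p ∸ b) (subst (z <_) (sym b+[p∸b]≡p) z<p)
      p∸b≤V : p ∸ b ≤ V
      p∸b≤V = s≤s⁻¹ (+-cancelˡ-< b (p ∸ b) (suc V) (subst (_< b + suc V) (sym b+[p∸b]≡p) (proj₂ (InRange-just eA (A⊂ x)))))

  A~A′ : SameType lab A lab A′
  A~A′ x y with position x | position y
  ... | unset ax a′x | _ = pairType-≡ ax refl a′x refl refl
  ... | before _ _ ax _ a′x _ _ _ ℓ≡ | unset ay a′y = pairType-≡ ax ay a′x a′y (pairType-single lab lab ℓ≡)
  ... | before _ _ ax _ a′x _ Fx F′x _ | before _ _ ay _ a′y _ Fy F′y _ =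
    pairType-≡ ax ay a′x a′y (pairType-≡ (sym Fx) (sym Fy) (sym F′x) (sym F′y) (F~F′ x y))
  ... | before _ _ ax p<z a′x q<z′ _ _ ℓ≡ | after u ay g<u _ a′y =
    pairType-≡ ax ay a′x a′y (pairType-<-cong lab lab (<-trans p<z z<b+u) (<-trans q<z′ z′<b′+u)
                               (¬⇔¬ (suc≢-beyond p<z z<b+u) (suc≢-beyond q<z′ z′<b′+u)) ℓ≡)
    where z<b+u = +-monoʳ-< b g<u
          z′<b′+u = +-monoʳ-< b′ g<u
  ... | after u ax _ u≤V a′x | unset ay a′y = pairType-≡ ax ay a′x a′y (pairType-single lab lab (window≡ u u≤V))
  ... | after u ax g<u u≤V a′x | before _ _ ay p<z a′y q<z′ _ _ _ =
    pairType-≡ ax ay a′x a′y (pairType->-cong lab lab (<-trans p<z (+-monoʳ-< b g<u)) (<-trans q<z′ (+-monoʳ-< b′ g<u)) (window≡ u u≤V))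
  ... | after u ax _ u≤V a′x | after v ay _ _ a′y =
    pairType-≡ ax ay a′x a′y (pairType-cong lab lab (window≡ u u≤V) (SameRel-translate b b′ u v))

  A′⊂ : Within 0 (b′ + suc V) A′
  A′⊂ x with position x
  ... | unset _ a′x = subst (InRange 0 _) (sym a′x) tt
  ... | before _ _ _ _ a′x q<z′ _ _ _ = subst (InRange 0 _) (sym a′x) (z≤n , <-≤-trans q<z′ (+-monoʳ-≤ b′ (m≤n⇒m≤1+n g≤V)))
  ... | after u _ _ u≤V a′x = subst (InRange 0 _) (sym a′x) (z≤n , +-monoʳ-< b′ (s≤s u≤V))

  hits-last : Hits⇔ A (b + V) A′ (b′ + V)
  hits-last x with position x
  ... | unset ax a′x = ¬⇔¬ (λ e → contradiction (trans (sym ax) e) λ ()) (λ e → contradiction (trans (sym a′x) e) λ ())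
  ... | before p q ax p<z a′x q<z′ _ _ _ =
    ¬⇔¬ (λ e → <-irrefl (just-injective (trans (sym ax) e)) (<-≤-trans p<z (+-monoʳ-≤ b g≤V)))
        (λ e → <-irrefl (just-injective (trans (sym a′x) e)) (<-≤-trans q<z′ (+-monoʳ-≤ b′ g≤V)))
  ... | after u ax _ _ a′x =
    mk⇔ (λ e → trans a′x (cong (λ v → just (b′ + v)) (+-cancelˡ-≡ b u V (just-injective (trans (sym ax) e)))))
        (λ e → trans ax (cong (λ v → just (b + v)) (+-cancelˡ-≡ b′ u V (just-injective (trans (sym a′x) e)))))

shiftPrefix : ∀ {t} V (lab : ℕ → Vec Bool t) (b b′ : ℕ) →
  (∀ u → u ≤ V → lab (b + u) ≡ lab (b′ + u)) →
  (∀ g → g ≤ V → Types⊆ V lab 0 (b + g) 0 (b′ + g)) →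
  (A : Tuple V) → Within 0 (b + suc V) A →
  Σ (Image lab lab A 0 (b′ + suc V)) λ I → Hits⇔ A (b + V) (Image.tuple I) (b′ + V)
shiftPrefix V lab b b′ window≡ prefix⊆ A A⊂ = image A′ A′⊂ A~A′ , hits-last
  where open ShiftPrefix V lab b b′ window≡ prefix⊆ A A⊂

-- The mirror image of ShiftPrefix: the window [b, b + V] is moved to
-- [b′, b′ + V] inside a suffix ending at N.
module ShiftSuffix {t} (V : ℕ) (lab : ℕ → Vec Bool t) (b b′ N : ℕ)
  (window≡ : ∀ u → u ≤ V → lab (b + u) ≡ lab (b′ + u))
  (suffix⊆ : ∀ g → g ≤ V → Types⊆ V lab (suc (b + g)) N (suc (b′ + g)) N)
  (b′+V<N : b′ + suc V ≤ N)
  (A : Tuple V) (A⊂ : Within b N A) where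

  opaque
    gap : Σ (Fin (suc V)) λ g → ∀ x → A x ≢ just (b + toℕ g)
    gap = missed A (λ g → b + toℕ g) (λ i j e → Fin.toℕ-injective (+-cancelˡ-≡ b _ _ e))

  g : ℕ
  g = toℕ (proj₁ gap)

  g≤V : g ≤ V
  g≤V = s≤s⁻¹ (Fin.toℕ<n (proj₁ gap))

  z z′ : ℕ
  z  = b + g
  z′ = b′ + g

  afterGap : Maybe ℕ → Maybe ℕ
  afterGap = splitOn (z <?_) just (λ _ → nothing)

  F : Tuple V
  F x = afterGap (A x)

  F⊂ : Within (suc z) N F
  F⊂ x = splitOn-preserves (z <?_) just (λ _ → nothing) {R = InRange b N} {R′ = InRange (suc z) N}
           tt (λ z<p (_ , p<N) → z<p , p<N) (λ _ _ → tt) (A x) (A⊂ x)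

  F-image : Image lab lab F (suc z′) N
  F-image = suffix⊆ g g≤V F F⊂
  open Image F-image renaming (tuple to F′; sameType to F~F′)

  A′-at : Fin V → Maybe ℕ → Maybe ℕ
  A′-at x = splitOn (z <?_) (λ _ → F′ x) (λ p → just (b′ + (p ∸ b)))

  A′ : Tuple V
  A′ x = A′-at x (A x)

  data Position (x : Fin V) : Set where
    unset  : A x ≡ nothing → A′ x ≡ nothing → Position x
    after  : ∀ p q → A x ≡ just p → z < p → A′ x ≡ just q → z′ < q → q < N → F x ≡ just p → F′ x ≡ just q → lab p ≡ lab q → Position x
    before : ∀ u → A x ≡ just (b + u) → u < g → A′ x ≡ just (b′ + u) → Position x

  position : ∀ x → Position x
  position x with A x in eA
  ... | nothing = unset eA (cong (A′-at x) eA)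
  ... | just p with z <? p
  ...   | yes z<p with Fx ← trans (cong afterGap eA) (splitOn-yes (z <?_) just _ z<p)
                  with q , F′x , (z′<q , q<N) , ℓ≡ ← image-just F-image Fx =
    after p q eA z<p (trans (trans (cong (A′-at x) eA) (splitOn-yes (z <?_) _ _ z<p)) F′x) z′<q q<N Fx F′x ℓ≡
  ...   | no z≮p = before (p ∸ b) (trans eA (cong just (sym b+[p∸b]≡p))) p∸b<g
                          (trans (cong (A′-at x) eA) (splitOn-no (z <?_) _ _ z≮p))
    where
      p<z : p < z
      p<z with <-cmp p z
      ... | tri< p<z _ _ = p<z
      ... | tri≈ _ p≡z _ = contradiction (trans eA (cong just p≡z)) (proj₂ gap x)
      ... | tri> _ _ z<p = contradiction z<p z≮p
      b+[p∸b]≡p : b + (p ∸ b) ≡ p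
      b+[p∸b]≡p = m+[n∸m]≡n (proj₁ (InRange-just eA (A⊂ x)))
      p∸b<g : p ∸ b < g
      p∸b<g = +-cancelˡ-< b (p ∸ b) g (subst (_< z) (sym b+[p∸b]≡p) p<z)

  A~A′ : SameType lab A lab A′
  A~A′ x y with position x | position y
  ... | unset ax a′x | _ = pairType-≡ ax refl a′x refl refl
  ... | after _ _ ax _ a′x _ _ _ _ ℓ≡ | unset ay a′y = pairType-≡ ax ay a′x a′y (pairType-single lab lab ℓ≡)
  ... | after _ _ ax _ a′x _ _ Fx F′x _ | after _ _ ay _ a′y _ _ Fy F′y _ =
    pairType-≡ ax ay a′x a′y (pairType-≡ (sym Fx) (sym Fy) (sym F′x) (sym F′y) (F~F′ x y))
  ... | after _ _ ax z<p a′x z′<q _ _ _ ℓ≡ | before u ay u<g a′y =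
    pairType-≡ ax ay a′x a′y (pairType->-cong lab lab (<-trans (+-monoʳ-< b u<g) z<p) (<-trans (+-monoʳ-< b′ u<g) z′<q) ℓ≡)
  ... | before u ax u<g a′x | unset ay a′y =
    pairType-≡ ax ay a′x a′y (pairType-single lab lab (window≡ u (<⇒≤ (<-≤-trans u<g g≤V))))
  ... | before u ax u<g a′x | after _ _ ay z<p a′y z′<q _ _ _ _ =
    pairType-≡ ax ay a′x a′y (pairType-<-cong lab lab (<-trans b+u<z z<p) (<-trans b′+u<z′ z′<q)
                               (¬⇔¬ (suc≢-beyond b+u<z z<p) (suc≢-beyond b′+u<z′ z′<q)) (window≡ u (<⇒≤ (<-≤-trans u<g g≤V))))
    where b+u<z = +-monoʳ-< b u<g
          b′+u<z′ = +-monoʳ-< b′ u<g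
  ... | before u ax u<g a′x | before v ay _ a′y =
    pairType-≡ ax ay a′x a′y (pairType-cong lab lab (window≡ u (<⇒≤ (<-≤-trans u<g g≤V))) (SameRel-translate b b′ u v))

  A′⊂ : Within b′ N A′
  A′⊂ x with position x
  ... | unset _ a′x = subst (InRange b′ N) (sym a′x) tt
  ... | after _ _ _ _ a′x z′<q q<N _ _ _ = subst (InRange b′ N) (sym a′x) (≤-trans (m≤m+n b′ g) (<⇒≤ z′<q) , q<N)
  ... | before u _ u<g a′x =
    subst (InRange b′ N) (sym a′x) (m≤m+n b′ u , <-≤-trans (+-monoʳ-< b′ (<-≤-trans u<g (m≤n⇒m≤1+n g≤V))) b′+V<N)

  hits-first : Hits⇔ A b A′ b′
  hits-first x with position x
  ... | unset ax a′x = ¬⇔¬ (λ e → contradiction (trans (sym ax) e) λ ()) (λ e → contradiction (trans (sym a′x) e) λ ())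
  ... | after p q ax z<p a′x z′<q _ _ _ _ =
    ¬⇔¬ (λ e → <-irrefl (sym (just-injective (trans (sym ax) e))) (≤-<-trans (m≤m+n b g) z<p))
        (λ e → <-irrefl (sym (just-injective (trans (sym a′x) e))) (≤-<-trans (m≤m+n b′ g) z′<q))
  ... | before u ax _ a′x =
    mk⇔ (λ e → trans a′x (cong just (+u≡ b′ (u≡0 b (just-injective (trans (sym ax) e))))))
        (λ e → trans ax (cong just (+u≡ b (u≡0 b′ (just-injective (trans (sym a′x) e))))))
    where u≡0 : ∀ c → c + u ≡ c → u ≡ 0
          u≡0 c e = +-cancelˡ-≡ c u 0 (trans e (sym (+-identityʳ c)))
          +u≡ : ∀ c → u ≡ 0 → c + u ≡ c
          +u≡ c refl = +-identityʳ c

shiftSuffix : ∀ {t} V (lab : ℕ → Vec Bool t) (b b′ N : ℕ) →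
  (∀ u → u ≤ V → lab (b + u) ≡ lab (b′ + u)) →
  (∀ g → g ≤ V → Types⊆ V lab (suc (b + g)) N (suc (b′ + g)) N) →
  b′ + suc V ≤ N →
  (A : Tuple V) → Within b N A →
  Σ (Image lab lab A b′ N) λ I → Hits⇔ A b (Image.tuple I) b′
shiftSuffix V lab b b′ N window≡ suffix⊆ b′+V<N A A⊂ = image A′ A′⊂ A~A′ , hits-first
  where open ShiftSuffix V lab b b′ N window≡ suffix⊆ b′+V<N A A⊂

-- Two windows of length 2V + 2 with the same letters at b₁ < b₂, such that
-- cutting out [b₁ + V + 1, b₂ + V + 1) changes no realised type on either side.
record Cut {t} (V : ℕ) (lab : ℕ → Vec Bool t) (N : ℕ) : Set where
  field
    b₁ b₂     : ℕ
    b₁<b₂     : b₁ < b₂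
    fits      : b₂ + suc V + suc V ≤ N
    window≡   : ∀ u → u ≤ V + suc V → lab (b₁ + u) ≡ lab (b₂ + u)
    prefix⊆   : Types⊆ V lab 0 (b₂ + suc V) 0 b₁
    suffix⊆   : Types⊆ V lab (b₁ + suc V) N (b₂ + suc V + suc V) N

module Excision {t} (V : ℕ) (lab : ℕ → Vec Bool t) (N : ℕ) (cut : Cut V lab N) where
  open Cut cut

  c₁ c₂ δ N′ : ℕ
  c₁ = b₁ + suc V
  c₂ = b₂ + suc V
  δ  = b₂ ∸ b₁
  N′ = c₁ + (N ∸ c₂)

  b₁≤b₂ : b₁ ≤ b₂
  b₁≤b₂ = <⇒≤ b₁<b₂

  c₁+δ≡c₂ : c₁ + δ ≡ c₂
  c₁+δ≡c₂ = begin
    b₁ + suc V + δ   ≡⟨ +-assoc b₁ (suc V) δ ⟩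
    b₁ + (suc V + δ) ≡⟨ cong (b₁ +_) (+-comm (suc V) δ) ⟩
    b₁ + (δ + suc V) ≡⟨ +-assoc b₁ δ (suc V) ⟨
    b₁ + δ + suc V   ≡⟨ cong (_+ suc V) (m+[n∸m]≡n b₁≤b₂) ⟩
    b₂ + suc V       ∎
    where open ≡-Reasoning

  c₂≤N : c₂ ≤ N
  c₂≤N = ≤-trans (m≤m+n c₂ (suc V)) fits

  N′+δ≡N : N′ + δ ≡ N
  N′+δ≡N = begin
    c₁ + (N ∸ c₂) + δ   ≡⟨ +-assoc c₁ (N ∸ c₂) δ ⟩
    c₁ + (N ∸ c₂ + δ)   ≡⟨ cong (c₁ +_) (+-comm (N ∸ c₂) δ) ⟩
    c₁ + (δ + (N ∸ c₂)) ≡⟨ +-assoc c₁ δ (N ∸ c₂) ⟨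
    c₁ + δ + (N ∸ c₂)   ≡⟨ cong (_+ (N ∸ c₂)) c₁+δ≡c₂ ⟩
    c₂ + (N ∸ c₂)       ≡⟨ m+[n∸m]≡n c₂≤N ⟩
    N                   ∎
    where open ≡-Reasoning

  c₁≤N′ : c₁ ≤ N′
  c₁≤N′ = m≤m+n c₁ (N ∸ c₂)

  N′<N : N′ < N
  N′<N = subst (N′ <_) N′+δ≡N (m<m+n N′ (m<n⇒0<n∸m b₁<b₂))

  -- Position q of the shortened word is position embed q of the original one.
  opaque
    embed : ℕ → ℕ
    embed q with q <? c₁
    ... | yes _ = q
    ... | no _  = q + δ

    embed-< : ∀ {q} → q < c₁ → embed q ≡ q
    embed-< {q} q<c₁ with q <? c₁
    ... | yes _   = refl
    ... | no q≮c₁ = contradiction q<c₁ q≮c₁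

    embed-≥ : ∀ {q} → c₁ ≤ q → embed q ≡ q + δ
    embed-≥ {q} c₁≤q with q <? c₁
    ... | yes q<c₁ = contradiction c₁≤q (<⇒≱ q<c₁)
    ... | no _     = refl

  lab′ : ℕ → Vec Bool t
  lab′ q = lab (embed q)

  lab′-< : ∀ {q} → q < c₁ → lab′ q ≡ lab q
  lab′-< = cong lab ∘ embed-<

  lab′-≥ : ∀ {q} → c₁ ≤ q → lab′ q ≡ lab (q + δ)
  lab′-≥ = cong lab ∘ embed-≥

  +δ<N : ∀ {p} → p < N′ → p + δ < N
  +δ<N {p} p<N′ = subst (p + δ <_) N′+δ≡N (+-monoˡ-< δ p<N′)

  embed<N : ∀ {q} → q < N′ → embed q < N
  embed<N {q} q<N′ with q <? c₁
  ... | yes q<c₁ = subst (_< N) (sym (embed-< q<c₁)) (<-≤-trans q<c₁ (≤-trans (m≤m+n c₁ δ) (≤-trans (≤-reflexive c₁+δ≡c₂) c₂≤N)))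
  ... | no q≮c₁  = subst (_< N) (sym (embed-≥ (≮⇒≥ q≮c₁))) (+δ<N q<N′)

  c₂≤+δ : ∀ {p} → c₁ ≤ p → c₂ ≤ p + δ
  c₂≤+δ {p} c₁≤p = subst (_≤ p + δ) c₁+δ≡c₂ (+-monoˡ-≤ δ c₁≤p)

  ∸δ+δ : ∀ {q} → c₂ ≤ q → q ∸ δ + δ ≡ q
  ∸δ+δ {q} c₂≤q = m∸n+n≡m (≤-trans (m≤n+m δ c₁) (subst (_≤ q) (sym c₁+δ≡c₂) c₂≤q))

  ∸δ<N′ : ∀ {q} → c₂ ≤ q → q < N → q ∸ δ < N′
  ∸δ<N′ {q} c₂≤q q<N = +-cancelʳ-< δ (q ∸ δ) N′ (subst₂ _<_ (sym (∸δ+δ c₂≤q)) (sym N′+δ≡N) q<N)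

  c₁≤∸δ : ∀ {q} → c₂ ≤ q → c₁ ≤ q ∸ δ
  c₁≤∸δ {q} c₂≤q = +-cancelʳ-≤ δ c₁ (q ∸ δ) (subst₂ _≤_ (sym c₁+δ≡c₂) (sym (∸δ+δ c₂≤q)) c₂≤q)

  lab′-∸δ : ∀ {q} → c₂ ≤ q → lab′ (q ∸ δ) ≡ lab q
  lab′-∸δ c₂≤q = trans (lab′-≥ (c₁≤∸δ c₂≤q)) (cong lab (∸δ+δ c₂≤q))

  SameRel-∸δ : ∀ {q r} → c₂ ≤ q → c₂ ≤ r → SameRel q r (q ∸ δ) (r ∸ δ)
  SameRel-∸δ {q} {r} c₂≤q c₂≤r =
    subst₂ (λ q′ r′ → SameRel q′ r′ (q ∸ δ) (r ∸ δ)) (∸δ+δ c₂≤q) (∸δ+δ c₂≤r) (SameRel-sym (SameRel-+ʳ δ (q ∸ δ) (r ∸ δ)))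

  ≡c₁⇔+δ≡c₂ : ∀ p → p ≡ c₁ ⇔ p + δ ≡ c₂
  ≡c₁⇔+δ≡c₂ p = mk⇔ (λ e → trans (cong (_+ δ) e) c₁+δ≡c₂) (λ e → +-cancelʳ-≡ δ p c₁ (trans e (sym c₁+δ≡c₂)))

  ≡c₂⇔∸δ≡c₁ : ∀ {q} → c₂ ≤ q → q ≡ c₂ ⇔ q ∸ δ ≡ c₁
  ≡c₂⇔∸δ≡c₁ c₂≤q = ⇔-sym (⇔-trans (≡c₁⇔+δ≡c₂ _) (mk⇔ (trans (sym (∸δ+δ c₂≤q))) (trans (∸δ+δ c₂≤q))))

  suc≡c₁⇔ : ∀ p → suc p ≡ c₁ ⇔ p ≡ b₁ + V
  suc≡c₁⇔ p = mk⇔ (λ e → suc-injective (trans e (+-suc b₁ V))) (λ e → trans (cong suc e) (sym (+-suc b₁ V)))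

  suc≡c₂⇔ : ∀ p → suc p ≡ c₂ ⇔ p ≡ b₂ + V
  suc≡c₂⇔ p = mk⇔ (λ e → suc-injective (trans e (+-suc b₂ V))) (λ e → trans (cong suc e) (sym (+-suc b₂ V)))

  window≡ˡ : ∀ u → u ≤ V → lab (b₁ + u) ≡ lab (b₂ + u)
  window≡ˡ u u≤V = window≡ u (≤-trans u≤V (m≤m+n V (suc V)))

  window≡ʳ : ∀ u → u ≤ V → lab (c₁ + u) ≡ lab (c₂ + u)
  window≡ʳ u u≤V = begin
    lab (b₁ + suc V + u)   ≡⟨ cong lab (+-assoc b₁ (suc V) u) ⟩
    lab (b₁ + (suc V + u)) ≡⟨ window≡ (suc V + u) (subst (suc V + u ≤_) (+-comm (suc V) V) (+-monoʳ-≤ (suc V) u≤V)) ⟩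
    lab (b₂ + (suc V + u)) ≡⟨ cong lab (+-assoc b₂ (suc V) u) ⟨
    lab (b₂ + suc V + u)   ∎
    where open ≡-Reasoning

  prefix⊆′ : ∀ g → g ≤ V → Types⊆ V lab 0 (b₂ + g) 0 (b₁ + g)
  prefix⊆′ g g≤V = Types⊆-trans V lab (Types⊆-mono V lab ≤-refl (+-monoʳ-≤ b₂ (m≤n⇒m≤1+n g≤V)))
                     (Types⊆-trans V lab prefix⊆ (Types⊆-mono V lab ≤-refl (m≤m+n b₁ g)))

  suffix⊆′ : ∀ g → g ≤ V → Types⊆ V lab (suc (c₁ + g)) N (suc (c₂ + g)) N
  suffix⊆′ g g≤V = Types⊆-trans V lab (Types⊆-mono V lab (≤-trans (m≤m+n c₁ g) (n≤1+n _)) ≤-refl)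
                     (Types⊆-trans V lab suffix⊆ (Types⊆-mono V lab (subst (_≤ c₂ + suc V) (+-suc c₂ g) (+-monoʳ-≤ c₂ (s≤s g≤V))) ≤-refl))

  -- Lifting a tuple of the shortened word: the part left of c₁ is moved from
  -- the window at b₁ to the window at b₂, the part right of it by δ.
  module Lift (A′ : Tuple V) (A′⊂ : Within 0 N′ A′) where

    L′ : Tuple V
    L′ x = splitOn (_<? c₁) just (λ _ → nothing) (A′ x)

    L′⊂ : Within 0 c₁ L′
    L′⊂ x = splitOn-preserves (_<? c₁) just (λ _ → nothing) {R = InRange 0 N′} {R′ = InRange 0 c₁}
              tt (λ p<c₁ _ → z≤n , p<c₁) (λ _ _ → tt) (A′ x) (A′⊂ x)

    opaque
      shifted : Σ (Image lab lab L′ 0 c₂) λ I → Hits⇔ L′ (b₁ + V) (Image.tuple I) (b₂ + V)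
      shifted = shiftPrefix V lab b₁ b₂ window≡ˡ (λ g _ → Types⊆-mono V lab ≤-refl (+-monoˡ-≤ g b₁≤b₂)) L′ L′⊂

    open Image (proj₁ shifted) renaming (tuple to L; sameType to L′~L)

    A-at : Fin V → Maybe ℕ → Maybe ℕ
    A-at x = splitOn (_<? c₁) (λ _ → L x) (λ p → just (p + δ))

    A : Tuple V
    A x = A-at x (A′ x)

    data Position (x : Fin V) : Set where
      unset : A′ x ≡ nothing → A x ≡ nothing → Position x
      left  : ∀ p q → A′ x ≡ just p → p < c₁ → A x ≡ just q → q < c₂ → L′ x ≡ just p → L x ≡ just q →
              (suc p ≡ c₁ ⇔ suc q ≡ c₂) → lab p ≡ lab q → Position x
      right : ∀ p → A′ x ≡ just p → c₁ ≤ p → p < N′ → A x ≡ just (p + δ) → Position x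

    position : ∀ x → Position x
    position x with A′ x in eA′
    ... | nothing = unset eA′ (cong (A-at x) eA′)
    ... | just p with p <? c₁
    ...   | yes p<c₁ with L′x ← trans (cong (splitOn (_<? c₁) just _) eA′) (splitOn-yes (_<? c₁) just _ p<c₁)
                     with q , Lx , (_ , q<c₂) , ℓ≡ ← image-just (proj₁ shifted) L′x =
      left p q eA′ p<c₁ (trans (trans (cong (A-at x) eA′) (splitOn-yes (_<? c₁) _ _ p<c₁)) Lx) q<c₂ L′x Lx
           (⇔-trans (suc≡c₁⇔ p) (⇔-trans (Hits⇔-at (proj₂ shifted) L′x Lx) (⇔-sym (suc≡c₂⇔ q)))) ℓ≡
    ...   | no p≮c₁ = right p eA′ (≮⇒≥ p≮c₁) (proj₂ (InRange-just eA′ (A′⊂ x)))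
                            (trans (cong (A-at x) eA′) (splitOn-no (_<? c₁) _ _ p≮c₁))

    A′~A : SameType lab′ A′ lab A
    A′~A x y with position x | position y
    ... | unset a′x ax | _ = pairType-≡ a′x refl ax refl refl
    ... | left _ _ a′x p<c₁ ax _ _ _ _ ℓ≡ | unset a′y ay =
      pairType-≡ a′x a′y ax ay (pairType-single lab′ lab (trans (lab′-< p<c₁) ℓ≡))
    ... | left p _ a′x p<c₁ ax _ L′x Lx _ _ | left p₂ _ a′y _ ay _ L′y Ly _ _ =
      pairType-≡ a′x a′y ax ay (trans (pairType-label lab′ lab (just p₂) (lab′-< p<c₁))
                                      (pairType-≡ (sym L′x) (sym L′y) (sym Lx) (sym Ly) (L′~L x y)))
    ... | left _ _ a′x p<c₁ ax q<c₂ _ _ adj ℓ≡ | right p₂ a′y c₁≤p₂ _ ay =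
      pairType-≡ a′x a′y ax ay (pairType-<-across lab′ lab p<c₁ c₁≤p₂ q<c₂ (c₂≤+δ c₁≤p₂) (trans (lab′-< p<c₁) ℓ≡)
                                                  adj (≡c₁⇔+δ≡c₂ p₂))
    ... | right _ a′x c₁≤p _ ax | unset a′y ay = pairType-≡ a′x a′y ax ay (pairType-single lab′ lab (lab′-≥ c₁≤p))
    ... | right _ a′x c₁≤p _ ax | left _ _ a′y p₂<c₁ ay q₂<c₂ _ _ _ _ =
      pairType-≡ a′x a′y ax ay (pairType->-cong lab′ lab (<-≤-trans p₂<c₁ c₁≤p) (<-≤-trans q₂<c₂ (c₂≤+δ c₁≤p)) (lab′-≥ c₁≤p))
    ... | right p a′x c₁≤p _ ax | right p₂ a′y _ _ ay =
      pairType-≡ a′x a′y ax ay (pairType-cong lab′ lab (lab′-≥ c₁≤p) (SameRel-+ʳ δ p p₂))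

    A⊂ : Within 0 N A
    A⊂ x with position x
    ... | unset _ ax = subst (InRange 0 N) (sym ax) tt
    ... | left _ _ _ _ ax q<c₂ _ _ _ _ = subst (InRange 0 N) (sym ax) (z≤n , <-≤-trans q<c₂ c₂≤N)
    ... | right _ _ _ p<N′ ax = subst (InRange 0 N) (sym ax) (z≤n , +δ<N p<N′)

  lift : (A′ : Tuple V) → Within 0 N′ A′ → Image lab′ lab A′ 0 N
  lift A′ A′⊂ = image A A⊂ A′~A
    where open Lift A′ A′⊂

  -- Lowering a tuple of the original word, for a prescribed position left of
  -- c₁: that part stays, the part from c₁ on is moved from the window at c₁ to
  -- the window at c₂ and then translated back by δ.
  module LowerLeft (A : Tuple V) (A⊂ : Within 0 N A) where

    R : Tuple V
    R x = splitOn (_<? c₁) (λ _ → nothing) just (A x)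

    R⊂ : Within c₁ N R
    R⊂ x = splitOn-preserves (_<? c₁) (λ _ → nothing) just {R = InRange 0 N} {R′ = InRange c₁ N}
             tt (λ _ _ → tt) (λ p≮c₁ (_ , p<N) → ≮⇒≥ p≮c₁ , p<N) (A x) (A⊂ x)

    opaque
      shifted : Σ (Image lab lab R c₂ N) λ I → Hits⇔ R c₁ (Image.tuple I) c₂
      shifted = shiftSuffix V lab c₁ c₂ N window≡ʳ suffix⊆′ fits R R⊂

    open Image (proj₁ shifted) renaming (tuple to R″; sameType to R~R″)

    A′-at : Fin V → Maybe ℕ → Maybe ℕ
    A′-at x = splitOn (_<? c₁) just (λ _ → Maybe.map (_∸ δ) (R″ x))

    A′ : Tuple V
    A′ x = A′-at x (A x)

    data Position (x : Fin V) : Set where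
      unset : A x ≡ nothing → A′ x ≡ nothing → Position x
      left  : ∀ p → A x ≡ just p → p < c₁ → A′ x ≡ just p → Position x
      right : ∀ p q → A x ≡ just p → c₁ ≤ p → R x ≡ just p → R″ x ≡ just q → c₂ ≤ q → q < N → A′ x ≡ just (q ∸ δ) →
              (p ≡ c₁ ⇔ q ≡ c₂) → lab p ≡ lab q → Position x

    position : ∀ x → Position x
    position x with A x in eA
    ... | nothing = unset eA (cong (A′-at x) eA)
    ... | just p with p <? c₁
    ...   | yes p<c₁ = left p eA p<c₁ (trans (cong (A′-at x) eA) (splitOn-yes (_<? c₁) _ _ p<c₁))
    ...   | no p≮c₁ with Rx ← trans (cong (splitOn (_<? c₁) _ just) eA) (splitOn-no (_<? c₁) _ just p≮c₁)
                    with q , R″x , (c₂≤q , q<N) , ℓ≡ ← image-just (proj₁ shifted) Rx =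
      right p q eA (≮⇒≥ p≮c₁) Rx R″x c₂≤q q<N
            (trans (cong (A′-at x) eA) (trans (splitOn-no (_<? c₁) _ _ p≮c₁) (cong (Maybe.map (_∸ δ)) R″x)))
            (Hits⇔-at (proj₂ shifted) Rx R″x) ℓ≡

    A~A′ : SameType lab A lab′ A′
    A~A′ x y with position x | position y
    ... | unset ax a′x | _ = pairType-≡ ax refl a′x refl refl
    ... | left _ ax p<c₁ a′x | unset ay a′y = pairType-≡ ax ay a′x a′y (pairType-single lab lab′ (sym (lab′-< p<c₁)))
    ... | left _ ax p<c₁ a′x | left p₂ ay _ a′y =
      pairType-≡ ax ay a′x a′y (pairType-label lab lab′ (just p₂) (sym (lab′-< p<c₁)))
    ... | left _ ax p<c₁ a′x | right _ q₂ ay c₁≤p₂ _ _ c₂≤q₂ _ a′y ≡c ℓ≡ =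
      pairType-≡ ax ay a′x a′y (pairType-<-across lab lab′ p<c₁ c₁≤p₂ p<c₁ (c₁≤∸δ c₂≤q₂) (sym (lab′-< p<c₁))
                                                  ⇔-refl (⇔-trans ≡c (≡c₂⇔∸δ≡c₁ c₂≤q₂)))
    ... | right _ _ ax _ _ _ c₂≤q _ a′x _ ℓ≡ | unset ay a′y =
      pairType-≡ ax ay a′x a′y (pairType-single lab lab′ (trans ℓ≡ (sym (lab′-∸δ c₂≤q))))
    ... | right _ _ ax c₁≤p _ _ c₂≤q _ a′x _ ℓ≡ | left _ ay p₂<c₁ a′y =
      pairType-≡ ax ay a′x a′y (pairType->-cong lab lab′ (<-≤-trans p₂<c₁ c₁≤p) (<-≤-trans p₂<c₁ (c₁≤∸δ c₂≤q))
                                                (trans ℓ≡ (sym (lab′-∸δ c₂≤q))))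
    ... | right _ q ax _ Rx R″x c₂≤q _ a′x _ _ | right _ q₂ ay _ Ry R″y c₂≤q₂ _ a′y _ _ =
      pairType-≡ ax ay a′x a′y (trans (pairType-≡ (sym Rx) (sym Ry) (sym R″x) (sym R″y) (R~R″ x y))
                                      (pairType-cong lab lab′ (sym (lab′-∸δ c₂≤q)) (SameRel-∸δ c₂≤q c₂≤q₂)))

    A′⊂ : Within 0 N′ A′
    A′⊂ x with position x
    ... | unset _ a′x = subst (InRange 0 N′) (sym a′x) tt
    ... | left _ _ p<c₁ a′x = subst (InRange 0 N′) (sym a′x) (z≤n , <-≤-trans p<c₁ c₁≤N′)
    ... | right _ _ _ _ _ _ c₂≤q q<N a′x _ _ = subst (InRange 0 N′) (sym a′x) (z≤n , ∸δ<N′ c₂≤q q<N)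

    keeps : ∀ {x p} → p < c₁ → A x ≡ just p → A′ x ≡ just p
    keeps {x} p<c₁ Ax with position x
    ... | unset ax _ = contradiction (trans (sym ax) Ax) λ ()
    ... | left _ ax _ a′x = trans a′x (cong just (just-injective (trans (sym ax) Ax)))
    ... | right _ _ ax c₁≤p _ _ _ _ _ _ _ = contradiction (subst (c₁ ≤_) (just-injective (trans (sym ax) Ax)) c₁≤p) (<⇒≱ p<c₁)

  -- Lowering for a prescribed position right of c₂: the part left of c₂ is
  -- moved from the window at b₂ to the window at b₁, the rest is translated
  -- back by δ.
  module LowerRight (A : Tuple V) (A⊂ : Within 0 N A) where

    L : Tuple V
    L x = splitOn (_<? c₂) just (λ _ → nothing) (A x)

    L⊂ : Within 0 c₂ L
    L⊂ x = splitOn-preserves (_<? c₂) just (λ _ → nothing) {R = InRange 0 N} {R′ = InRange 0 c₂}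
             tt (λ p<c₂ _ → z≤n , p<c₂) (λ _ _ → tt) (A x) (A⊂ x)

    opaque
      shifted : Σ (Image lab lab L 0 c₁) λ I → Hits⇔ L (b₂ + V) (Image.tuple I) (b₁ + V)
      shifted = shiftPrefix V lab b₂ b₁ (λ u u≤V → sym (window≡ˡ u u≤V)) prefix⊆′ L L⊂

    open Image (proj₁ shifted) renaming (tuple to L′; sameType to L~L′)

    A′-at : Fin V → Maybe ℕ → Maybe ℕ
    A′-at x = splitOn (_<? c₂) (λ _ → L′ x) (λ p → just (p ∸ δ))

    A′ : Tuple V
    A′ x = A′-at x (A x)

    data Position (x : Fin V) : Set where
      unset : A x ≡ nothing → A′ x ≡ nothing → Position x
      left  : ∀ p q → A x ≡ just p → p < c₂ → A′ x ≡ just q → q < c₁ → L x ≡ just p → L′ x ≡ just q →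
              (suc p ≡ c₂ ⇔ suc q ≡ c₁) → lab p ≡ lab q → Position x
      right : ∀ p → A x ≡ just p → c₂ ≤ p → p < N → A′ x ≡ just (p ∸ δ) → Position x

    position : ∀ x → Position x
    position x with A x in eA
    ... | nothing = unset eA (cong (A′-at x) eA)
    ... | just p with p <? c₂
    ...   | yes p<c₂ with Lx ← trans (cong (splitOn (_<? c₂) just _) eA) (splitOn-yes (_<? c₂) just _ p<c₂)
                     with q , L′x , (_ , q<c₁) , ℓ≡ ← image-just (proj₁ shifted) Lx =
      left p q eA p<c₂ (trans (trans (cong (A′-at x) eA) (splitOn-yes (_<? c₂) _ _ p<c₂)) L′x) q<c₁ Lx L′x
           (⇔-trans (suc≡c₂⇔ p) (⇔-trans (Hits⇔-at (proj₂ shifted) Lx L′x) (⇔-sym (suc≡c₁⇔ q)))) ℓ≡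
    ...   | no p≮c₂ = right p eA (≮⇒≥ p≮c₂) (proj₂ (InRange-just eA (A⊂ x)))
                            (trans (cong (A′-at x) eA) (splitOn-no (_<? c₂) _ _ p≮c₂))

    A~A′ : SameType lab A lab′ A′
    A~A′ x y with position x | position y
    ... | unset ax a′x | _ = pairType-≡ ax refl a′x refl refl
    ... | left _ _ ax _ a′x q<c₁ _ _ _ ℓ≡ | unset ay a′y =
      pairType-≡ ax ay a′x a′y (pairType-single lab lab′ (trans ℓ≡ (sym (lab′-< q<c₁))))
    ... | left _ _ ax _ a′x q<c₁ Lx L′x _ _ | left _ q₂ ay _ a′y _ Ly L′y _ _ =
      pairType-≡ ax ay a′x a′y (trans (pairType-≡ (sym Lx) (sym Ly) (sym L′x) (sym L′y) (L~L′ x y))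
                                      (pairType-label lab lab′ (just q₂) (sym (lab′-< q<c₁))))
    ... | left _ _ ax p<c₂ a′x q<c₁ _ _ adj ℓ≡ | right _ ay c₂≤p₂ _ a′y =
      pairType-≡ ax ay a′x a′y (pairType-<-across lab lab′ p<c₂ c₂≤p₂ q<c₁ (c₁≤∸δ c₂≤p₂) (trans ℓ≡ (sym (lab′-< q<c₁)))
                                                  adj (≡c₂⇔∸δ≡c₁ c₂≤p₂))
    ... | right _ ax c₂≤p _ a′x | unset ay a′y =
      pairType-≡ ax ay a′x a′y (pairType-single lab lab′ (sym (lab′-∸δ c₂≤p)))
    ... | right _ ax c₂≤p _ a′x | left _ _ ay p₂<c₂ a′y q₂<c₁ _ _ _ _ =
      pairType-≡ ax ay a′x a′y (pairType->-cong lab lab′ (<-≤-trans p₂<c₂ c₂≤p) (<-≤-trans q₂<c₁ (c₁≤∸δ c₂≤p))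
                                                (sym (lab′-∸δ c₂≤p)))
    ... | right _ ax c₂≤p _ a′x | right _ ay c₂≤p₂ _ a′y =
      pairType-≡ ax ay a′x a′y (pairType-cong lab lab′ (sym (lab′-∸δ c₂≤p)) (SameRel-∸δ c₂≤p c₂≤p₂))

    A′⊂ : Within 0 N′ A′
    A′⊂ x with position x
    ... | unset _ a′x = subst (InRange 0 N′) (sym a′x) tt
    ... | left _ _ _ _ a′x q<c₁ _ _ _ _ = subst (InRange 0 N′) (sym a′x) (z≤n , <-≤-trans q<c₁ c₁≤N′)
    ... | right _ _ c₂≤p p<N a′x = subst (InRange 0 N′) (sym a′x) (z≤n , ∸δ<N′ c₂≤p p<N)

    translates : ∀ {x q} → c₁ ≤ q → A x ≡ just (q + δ) → A′ x ≡ just q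
    translates {x} {q} c₁≤q Ax with position x
    ... | unset ax _ = contradiction (trans (sym ax) Ax) λ ()
    ... | left _ _ ax p<c₂ _ _ _ _ _ _ =
      contradiction (subst (c₂ ≤_) (sym (just-injective (trans (sym ax) Ax))) (c₂≤+δ c₁≤q)) (<⇒≱ p<c₂)
    ... | right _ ax _ _ a′x = trans a′x (cong just (trans (cong (_∸ δ) (just-injective (trans (sym ax) Ax))) (m+n∸n≡m q δ)))

  lower : (A : Tuple V) → Within 0 N A → ∀ {x₀} a′ → A x₀ ≡ just (embed a′) →
          Σ (Image lab lab′ A 0 N′) λ I → Image.tuple I x₀ ≡ just a′
  lower A A⊂ a′ Ax₀ with a′ <? c₁
  ... | yes a′<c₁ = image A′ A′⊂ A~A′ , keeps a′<c₁ (trans Ax₀ (cong just (embed-< a′<c₁)))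
    where open LowerLeft A A⊂
  ... | no a′≮c₁ = image A′ A′⊂ A~A′ , translates (≮⇒≥ a′≮c₁) (trans Ax₀ (cong just (embed-≥ (≮⇒≥ a′≮c₁))))
    where open LowerRight A A⊂

Window : ℕ → ℕ → Set
Window t V = Vec (Vec Bool t) (suc (V + suc V))

window : ∀ {t} V → (ℕ → Vec Bool t) → ℕ → Window t V
window V lab b = tabulate λ u → lab (b + toℕ u)

allWindows : ∀ t V → List (Window t V)
allWindows t V = vectors (vectors bools t) (suc (V + suc V))

∈-allWindows : ∀ {t} V (lab : ℕ → Vec Bool t) b → window V lab b ∈ allWindows t V
∈-allWindows V lab b = ∈-vectors _ _ (λ _ → ∈-vectors _ _ (λ _ → ∈-bools _))

window-≡ : ∀ {t} V (lab : ℕ → Vec Bool t) b₁ b₂ → window V lab b₁ ≡ window V lab b₂ →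
           ∀ u → u ≤ V + suc V → lab (b₁ + u) ≡ lab (b₂ + u)
window-≡ V lab b₁ b₂ e u u≤ = begin
  lab (b₁ + u)                          ≡⟨ cong (λ v → lab (b₁ + v)) (Fin.toℕ-fromℕ< (s≤s u≤)) ⟨
  lab (b₁ + toℕ i)                      ≡⟨ Vec.lookup∘tabulate (λ v → lab (b₁ + toℕ v)) i ⟨
  lookup (window V lab b₁) i            ≡⟨ cong (λ w → lookup w i) e ⟩
  lookup (window V lab b₂) i            ≡⟨ Vec.lookup∘tabulate (λ v → lab (b₂ + toℕ v)) i ⟩
  lab (b₂ + toℕ i)                      ≡⟨ cong (λ v → lab (b₂ + v)) (Fin.toℕ-fromℕ< (s≤s u≤)) ⟩
  lab (b₂ + u)                          ∎
  where open ≡-Reasoning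
        i = fromℕ< (s≤s u≤)

monotone-plateau : (f : ℕ → ℕ) → (∀ k → f k ≤ f (suc k)) → ∀ K →
                   (Σ ℕ λ k → k < K × f k ≡ f (suc k)) ⊎ (K + f 0 ≤ f K)
monotone-plateau f f-mono zero = inj₂ ≤-refl
monotone-plateau f f-mono (suc K) with monotone-plateau f f-mono K
... | inj₁ (k , k<K , e) = inj₁ (k , m<n⇒m<1+n k<K , e)
... | inj₂ grows with f K ≟ f (suc K)
...   | yes e  = inj₁ (K , n<1+n K , e)
...   | no ne = inj₂ (≤-trans (s≤s grows) (≤∧≢⇒< (f-mono K) ne))

+-mono-≤-≡⇒≡ : ∀ {a a′ x x′} → a ≤ a′ → x ≤ x′ → a + x ≡ a′ + x′ → a ≡ a′ × x ≡ x′
+-mono-≤-≡⇒≡ {a} {a′} {x} {x′} a≤a′ x≤x′ e with a ≟ a′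
... | yes refl = refl , +-cancelˡ-≡ a x x′ e
... | no a≢a′  = contradiction e (<⇒≢ (+-mono-<-≤ (≤∧≢⇒< a≤a′ a≢a′) x≤x′))

#windows : ℕ → ℕ → ℕ
#windows t V = length (allWindows t V)

blockLength : ℕ → ℕ → ℕ
blockLength t V = #windows t V + (suc V + suc V)

cutThreshold : ℕ → ℕ → ℕ
cutThreshold t V = suc (#typeMatrices V t + #typeMatrices V t) * blockLength t V

-- Φ c counts the types realised in [0, c) plus the types not realised in
-- [c, N); it is monotone and bounded by 2M, so among 2M + 1 consecutive blocks
-- one leaves Φ unchanged.  Inside that block two of its first #windows + 1
-- positions start equal windows.
module FindCut {t} (V : ℕ) (lab : ℕ → Vec Bool t) (N : ℕ) (long : cutThreshold t V ≤ N) where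

  M D : ℕ
  M = #typeMatrices V t
  D = blockLength t V

  Φ : ℕ → ℕ
  Φ c = #types V lab 0 c + (M ∸ #types V lab c N)

  Φ-mono : ∀ {c c′} → c ≤ c′ → Φ c ≤ Φ c′
  Φ-mono c≤c′ = +-mono-≤ (#types-mono V lab ≤-refl c≤c′) (∸-monoʳ-≤ M (#types-mono V lab c≤c′ ≤-refl))

  Φ≤2M : ∀ c → Φ c ≤ M + M
  Φ≤2M c = +-mono-≤ (#types≤ V lab 0 c) (m∸n≤m M (#types V lab c N))

  plateau : Σ ℕ λ k → k < suc (M + M) × Φ (k * D) ≡ Φ (suc k * D)
  plateau with monotone-plateau (λ k → Φ (k * D)) (λ k → Φ-mono (m≤n+m (k * D) D)) (suc (M + M))
  ... | inj₁ found = found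
  ... | inj₂ grows = contradiction (≤-trans (m≤m+n _ _) grows) (<⇒≱ (s≤s (Φ≤2M _)))

  k c c′ : ℕ
  k  = proj₁ plateau
  c  = k * D
  c′ = D + k * D

  c≤c′ : c ≤ c′
  c≤c′ = m≤n+m c D

  c′≤N : c′ ≤ N
  c′≤N = ≤-trans (*-monoˡ-≤ D (proj₁ (proj₂ plateau))) long

  #types-steady : #types V lab 0 c ≡ #types V lab 0 c′ × (M ∸ #types V lab c N) ≡ (M ∸ #types V lab c′ N)
  #types-steady = +-mono-≤-≡⇒≡ (#types-mono V lab ≤-refl c≤c′) (∸-monoʳ-≤ M (#types-mono V lab c≤c′ ≤-refl)) (proj₂ (proj₂ plateau))

  left⊆ : Types⊆ V lab 0 c′ 0 c
  left⊆ = #types-≡⇒Types⊆ V lab ≤-refl c≤c′ (proj₁ #types-steady)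

  right⊆ : Types⊆ V lab c N c′ N
  right⊆ = #types-≡⇒Types⊆ V lab c≤c′ ≤-refl
             (trans (sym (m∸[m∸n]≡n (#types≤ V lab c′ N)))
                    (trans (cong (M ∸_) (sym (proj₂ #types-steady))) (m∸[m∸n]≡n (#types≤ V lab c N))))

  repeat : Σ (Fin (suc (#windows t V))) λ i → Σ (Fin (suc (#windows t V))) λ j → i <ᶠ j ×
             Any.index (∈-allWindows V lab (c + toℕ i)) ≡ Any.index (∈-allWindows V lab (c + toℕ j))
  repeat = Fin.pigeonhole (n<1+n _) (λ j → Any.index (∈-allWindows V lab (c + toℕ j)))

  i j : Fin (suc (#windows t V))
  i = proj₁ repeat
  j = proj₁ (proj₂ repeat)

  b₁ b₂ : ℕ
  b₁ = c + toℕ i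
  b₂ = c + toℕ j

  b₂-fits : b₂ + suc V + suc V ≤ c′
  b₂-fits = begin
    c + toℕ j + suc V + suc V         ≡⟨ +-assoc (c + toℕ j) (suc V) (suc V) ⟩
    c + toℕ j + (suc V + suc V)       ≤⟨ +-monoˡ-≤ (suc V + suc V) (+-monoʳ-≤ c (s≤s⁻¹ (Fin.toℕ<n j))) ⟩
    c + #windows t V + (suc V + suc V) ≡⟨ +-assoc c (#windows t V) (suc V + suc V) ⟩
    c + D                             ≡⟨ +-comm c D ⟩
    c′                                ∎
    where open ≤-Reasoning

  cut : Cut V lab N
  cut = record
    { b₁      = b₁
    ; b₂      = b₂
    ; b₁<b₂   = +-monoʳ-< c (proj₁ (proj₂ (proj₂ repeat)))
    ; fits    = ≤-trans b₂-fits c′≤N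
    ; window≡ = window-≡ V lab b₁ b₂ (index-injective (setoid _) (∈-allWindows V lab b₁) (∈-allWindows V lab b₂) (proj₂ (proj₂ (proj₂ repeat))))
    ; prefix⊆ = Types⊆-trans V lab (Types⊆-mono V lab ≤-refl (≤-trans (m≤m+n (b₂ + suc V) (suc V)) b₂-fits))
                  (Types⊆-trans V lab left⊆ (Types⊆-mono V lab ≤-refl (m≤m+n c (toℕ i))))
    ; suffix⊆ = Types⊆-trans V lab (Types⊆-mono V lab (≤-trans (m≤m+n c (toℕ i)) (m≤m+n b₁ (suc V))) ≤-refl)
                  (Types⊆-trans V lab right⊆ (Types⊆-mono V lab b₂-fits ≤-refl))
    }

predicates : ∀ {s n} → Formula s n → List (Fin s)
predicates ⊤'          = []
predicates (rel P _)   = P ∷ []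
predicates (succ' _ _) = []
predicates (lt _ _)    = []
predicates (eq _ _)    = []
predicates (¬' φ)      = predicates φ
predicates (φ ∧' ψ)    = predicates φ ++ predicates ψ
predicates (φ ∨' ψ)    = predicates φ ++ predicates ψ
predicates (∃' φ)      = predicates φ
predicates (∀' φ)      = predicates φ

letters : ∀ {s} → (Fin s → Bool) → (Ps : List (Fin s)) → Vec Bool (length Ps)
letters f []       = []
letters f (P ∷ Ps) = f P ∷ letters f Ps

letters-≡ : ∀ {s} {f g : Fin s → Bool} {P} (Ps : List (Fin s)) → P ∈ Ps → letters f Ps ≡ letters g Ps → f P ≡ g P
letters-≡ (_ ∷ Ps) (here refl) e = proj₁ (Vec.∷-injective e)
letters-≡ (_ ∷ Ps) (there P∈) e = letters-≡ Ps P∈ (proj₂ (Vec.∷-injective e))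

-- The letters over Ps of a word, as a labelling of all of ℕ (junk beyond the word).
labelling : ∀ {s} → Word s → (Ps : List (Fin s)) → ℕ → Vec Bool (length Ps)
labelling w Ps p with p <? size w
... | yes p<size = letters (label w (fromℕ< p<size)) Ps
... | no _       = replicate _ false

labelling-toℕ : ∀ {s} (w : Word s) Ps (i : Fin (size w)) → labelling w Ps (toℕ i) ≡ letters (label w i) Ps
labelling-toℕ w Ps i with toℕ i <? size w
... | yes i<size = cong (λ j → letters (label w j) Ps) (Fin.fromℕ<-toℕ i i<size)
... | no i≮size  = contradiction (Fin.toℕ<n i) i≮size

Indistinguishable : ∀ {s n} (Ps : List (Fin s)) (w : Word s) → (Fin n → Fin (size w)) → (w′ : Word s) → (Fin n → Fin (size w′)) → Set
Indistinguishable Ps w ρ w′ ρ′ =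
  ∀ x y → pairType (labelling w Ps) (just (toℕ (ρ x))) (just (toℕ (ρ y))) ≡ pairType (labelling w′ Ps) (just (toℕ (ρ′ x))) (just (toℕ (ρ′ y)))

Indistinguishable-≗ : ∀ {s n} (Ps : List (Fin s)) (w : Word s) (ρ ρ′ : Fin n → Fin (size w)) → (∀ x → ρ x ≡ ρ′ x) →
                      Indistinguishable Ps w ρ w ρ′
Indistinguishable-≗ Ps w ρ ρ′ ρ≗ρ′ x y rewrite ρ≗ρ′ x | ρ≗ρ′ y = refl

module _ {s n} (Ps : List (Fin s)) (w w′ : Word s) (ρ : Fin n → Fin (size w)) (ρ′ : Fin n → Fin (size w′))
         (ρ≈ρ′ : Indistinguishable Ps w ρ w′ ρ′) where

  private
    sameRel : ∀ x y → SameRel (toℕ (ρ x)) (toℕ (ρ y)) (toℕ (ρ′ x)) (toℕ (ρ′ y))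
    sameRel x y = proj₂ (pairType-injective (labelling w Ps) (labelling w′ Ps) (ρ≈ρ′ x y))

    sameLabel : ∀ {P} x → P ∈ Ps → label w (ρ x) P ≡ label w′ (ρ′ x) P
    sameLabel x P∈ = letters-≡ Ps P∈ (begin
      letters (label w (ρ x)) Ps      ≡⟨ labelling-toℕ w Ps (ρ x) ⟨
      labelling w Ps (toℕ (ρ x))      ≡⟨ pairType-diag⇒label (labelling w Ps) (labelling w′ Ps) (ρ≈ρ′ x x) ⟩
      labelling w′ Ps (toℕ (ρ′ x))    ≡⟨ labelling-toℕ w′ Ps (ρ′ x) ⟩
      letters (label w′ (ρ′ x)) Ps    ∎)
      where open ≡-Reasoning

  qf-invariant : ∀ {φ : Formula s n} → QF φ → predicates φ ⊆ Ps → Sat w ρ φ ⇔ Sat w′ ρ′ φ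
  qf-invariant ⊤'          _   = ⇔-refl
  qf-invariant (rel P x)   P⊆ = mk⇔ (trans (sym (sameLabel x (P⊆ (here refl))))) (trans (sameLabel x (P⊆ (here refl))))
  qf-invariant (succ' x y) _   = let succ⇔ = proj₁ (proj₂ (sameRel x y)) in mk⇔ (sym ∘ to succ⇔ ∘ sym) (sym ∘ from succ⇔ ∘ sym)
  qf-invariant (lt x y)    _   = proj₁ (sameRel x y)
  qf-invariant (eq x y)    _   =
    let ≡⇔ = proj₂ (proj₂ (sameRel x y)) in mk⇔ (Fin.toℕ-injective ∘ to ≡⇔ ∘ cong toℕ) (Fin.toℕ-injective ∘ from ≡⇔ ∘ cong toℕ)
  qf-invariant (¬' q)      P⊆ = let φ⇔ = qf-invariant q P⊆ in mk⇔ (λ ¬φ → ¬φ ∘ from φ⇔) (λ ¬φ → ¬φ ∘ to φ⇔)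
  qf-invariant (_∧'_ {φ = φ} q r) P⊆ =
    qf-invariant q (P⊆ ∘ ∈-++⁺ˡ) ×-⇔ qf-invariant r (P⊆ ∘ ∈-++⁺ʳ (predicates φ))
  qf-invariant (_∨'_ {φ = φ} q r) P⊆ =
    qf-invariant q (P⊆ ∘ ∈-++⁺ˡ) ⊎-⇔ qf-invariant r (P⊆ ∘ ∈-++⁺ʳ (predicates φ))

prepend : ∀ {A : Set} k {n} → (Fin k → A) → (Fin n → A) → Fin (k + n) → A
prepend zero    σ ρ = ρ
prepend (suc k) σ ρ = σ Fin.zero ∷ᶠ prepend k (σ ∘ Fin.suc) ρ

front : ∀ {A : Set} k {n} → (Fin (k + n) → A) → Fin k → A
front (suc k) ρ Fin.zero    = ρ Fin.zero
front (suc k) ρ (Fin.suc i) = front k (ρ ∘ Fin.suc) i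

back : ∀ {A : Set} k {n} → (Fin (k + n) → A) → Fin n → A
back k ρ i = ρ (k ↑ʳ i)

prepend-cong : ∀ {A : Set} k {n} {σ σ′ : Fin k → A} {ρ ρ′ : Fin n → A} →
               (∀ i → σ i ≡ σ′ i) → (∀ i → ρ i ≡ ρ′ i) → ∀ i → prepend k σ ρ i ≡ prepend k σ′ ρ′ i
prepend-cong zero    σ≗σ′ ρ≗ρ′ i           = ρ≗ρ′ i
prepend-cong (suc k) σ≗σ′ ρ≗ρ′ Fin.zero    = σ≗σ′ Fin.zero
prepend-cong (suc k) σ≗σ′ ρ≗ρ′ (Fin.suc i) = prepend-cong k (σ≗σ′ ∘ Fin.suc) ρ≗ρ′ i

prepend-front-back : ∀ {A : Set} k {n} (ρ : Fin (k + n) → A) → ∀ i → prepend k (front k ρ) (back k ρ) i ≡ ρ i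
prepend-front-back zero    ρ i           = refl
prepend-front-back (suc k) ρ Fin.zero    = refl
prepend-front-back (suc k) ρ (Fin.suc i) = prepend-front-back k (ρ ∘ Fin.suc) i

prepend-↑ʳ : ∀ {A : Set} k {n} (σ : Fin k → A) (ρ : Fin n → A) i → prepend k σ ρ (k ↑ʳ i) ≡ ρ i
prepend-↑ʳ zero    σ ρ i = refl
prepend-↑ʳ (suc k) σ ρ i = prepend-↑ʳ k (σ ∘ Fin.suc) ρ i

module _ {s} (w : Word s) where

  Sat-∀s : ∀ {n} k (ρ : Fin n → Fin (size w)) (φ : Formula s (k + n)) →
           Sat w ρ (∀s k φ) ⇔ (∀ σ → Sat w (prepend k σ ρ) φ)
  Sat-∀s zero    ρ φ = mk⇔ (λ h _ → h) (λ h → h (λ ()))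
  Sat-∀s (suc k) ρ φ = let ∀⇔ = Sat-∀s k ρ (∀' φ) in
    mk⇔ (λ h σ → to ∀⇔ h (σ ∘ Fin.suc) (σ Fin.zero)) (λ h → from ∀⇔ (λ σ a → h (a ∷ᶠ σ)))

  Sat-∃s : ∀ {n} k (ρ : Fin n → Fin (size w)) (φ : Formula s (k + n)) →
           Sat w ρ (∃s k φ) ⇔ (Σ (Fin k → Fin (size w)) λ σ → Sat w (prepend k σ ρ) φ)
  Sat-∃s zero    ρ φ = mk⇔ (λ h → (λ ()) , h) proj₂
  Sat-∃s (suc k) ρ φ = let ∃⇔ = Sat-∃s k ρ (∃' φ) in
    mk⇔ (λ h → let (σ , a , sat) = to ∃⇔ h in a ∷ᶠ σ , sat) (λ (σ , sat) → from ∃⇔ (σ ∘ Fin.suc , σ Fin.zero , sat))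

  Sat-⋀ : ∀ {n} (ρ : Fin n → Fin (size w)) (φs : List (Formula s n)) → Sat w ρ (⋀ φs) ⇔ All (Sat w ρ) φs
  Sat-⋀ ρ []           = mk⇔ (λ _ → []) (λ _ → tt)
  Sat-⋀ ρ (φ ∷ [])     = mk⇔ (_∷ []) (λ { (h ∷ []) → h })
  Sat-⋀ ρ (φ ∷ ψs@(_ ∷ _)) = let ⋀⇔ = Sat-⋀ ρ ψs in
    mk⇔ (λ sat → proj₁ sat ∷ to ⋀⇔ (proj₂ sat)) (λ sats → All.head sats , from ⋀⇔ (All.tail sats))

len-∃s : ∀ {s n} k (φ : Formula s (k + n)) → k + len φ ≤ len (∃s k φ)
len-∃s zero    φ = ≤-refl
len-∃s (suc k) φ = ≤-trans (≤-reflexive (sym (+-suc k (len φ)))) (≤-trans (+-monoʳ-≤ k (n≤1+n _)) (len-∃s k (∃' φ)))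

len-∀s : ∀ {s n} k (φ : Formula s (k + n)) → k + len φ ≤ len (∀s k φ)
len-∀s zero    φ = ≤-refl
len-∀s (suc k) φ = ≤-trans (≤-reflexive (sym (+-suc k (len φ)))) (≤-trans (+-monoʳ-≤ k (n≤1+n _)) (len-∀s k (∀' φ)))

predicates-∃s : ∀ {s n} k (φ : Formula s (k + n)) → predicates (∃s k φ) ≡ predicates φ
predicates-∃s zero    φ = refl
predicates-∃s (suc k) φ = predicates-∃s k (∃' φ)

predicates-∀s : ∀ {s n} k (φ : Formula s (k + n)) → predicates (∀s k φ) ≡ predicates φ
predicates-∀s zero    φ = refl
predicates-∀s (suc k) φ = predicates-∀s k (∀' φ)

len-∈-⋀ : ∀ {s n} {φ : Formula s n} (φs : List (Formula s n)) → φ ∈ φs → len φ ≤ len (⋀ φs)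
len-∈-⋀ (φ ∷ [])     (here refl) = ≤-refl
len-∈-⋀ (φ ∷ ψ ∷ ψs) (here refl) = ≤-trans (m≤m+n (len φ) _) (n≤1+n _)
len-∈-⋀ (φ ∷ ψ ∷ ψs) (there φ∈) = ≤-trans (len-∈-⋀ (ψ ∷ ψs) φ∈) (≤-trans (m≤n+m _ (len φ)) (n≤1+n _))

predicates-∈-⋀ : ∀ {s n} {φ : Formula s n} (φs : List (Formula s n)) → φ ∈ φs → predicates φ ⊆ predicates (⋀ φs)
predicates-∈-⋀ (φ ∷ [])     (here refl) = id
predicates-∈-⋀ (φ ∷ ψ ∷ ψs) (here refl) = ∈-++⁺ˡ
predicates-∈-⋀ (φ ∷ ψ ∷ ψs) (there φ∈) = ∈-++⁺ʳ (predicates φ) ∘ predicates-∈-⋀ (ψ ∷ ψs) φ∈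

length-predicates : ∀ {s n} (φ : Formula s n) → length (predicates φ) ≤ len φ
length-predicates ⊤'          = z≤n
length-predicates (rel _ _)   = s≤s z≤n
length-predicates (succ' _ _) = z≤n
length-predicates (lt _ _)    = z≤n
length-predicates (eq _ _)    = z≤n
length-predicates (¬' φ)      = m≤n⇒m≤1+n (length-predicates φ)
length-predicates (φ ∧' ψ)    = m≤n⇒m≤1+n (≤-trans (≤-reflexive (length-++ (predicates φ))) (+-mono-≤ (length-predicates φ) (length-predicates ψ)))
length-predicates (φ ∨' ψ)    = m≤n⇒m≤1+n (≤-trans (≤-reflexive (length-++ (predicates φ))) (+-mono-≤ (length-predicates φ) (length-predicates ψ)))
length-predicates (∃' φ)      = m≤n⇒m≤1+n (m≤n⇒m≤1+n (length-predicates φ))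
length-predicates (∀' φ)      = m≤n⇒m≤1+n (m≤n⇒m≤1+n (length-predicates φ))

-- The back-and-forth conditions under which normal forms of length ≤ V over
-- the letters Ps pass from w to w′: the ∀-conjuncts need lift, the
-- ∀∃-conjuncts need lower, which keeps a prescribed image of the ∀-variable.
module Transfer {s} (Ps : List (Fin s)) (V : ℕ) (w w′ : Word s) (emb : Fin (size w′) → Fin (size w))
  (lift : ∀ {n} → n ≤ V → (ρ′ : Fin n → Fin (size w′)) → Σ (Fin n → Fin (size w)) λ ρ → Indistinguishable Ps w ρ w′ ρ′)
  (lower : ∀ {n} → n ≤ V → (ρ : Fin n → Fin (size w)) {x₀ : Fin n} (a′ : Fin (size w′)) → ρ x₀ ≡ emb a′ →
           Σ (Fin n → Fin (size w′)) λ ρ′ → Indistinguishable Ps w ρ w′ ρ′ × ρ′ x₀ ≡ a′)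
  where

  sat-≗ : ∀ {n} {u : Word s} {ρ ρ′ : Fin n → Fin (size u)} {φ : Formula s n} → (∀ i → ρ i ≡ ρ′ i) → QF φ →
          predicates φ ⊆ Ps → Sat u ρ φ → Sat u ρ′ φ
  sat-≗ {u = u} {ρ} {ρ′} ρ≗ρ′ qf φ⊆ = to (qf-invariant Ps u u ρ ρ′ (Indistinguishable-≗ Ps u ρ ρ′ ρ≗ρ′) qf φ⊆)

  module _ (ρ₀ : Fin 0 → Fin (size w)) (ρ₀′ : Fin 0 → Fin (size w′)) where

    exConj-transfer : (c : ExConj s) → len (exConj c) ≤ V → predicates (exConj c) ⊆ Ps → Sat w ρ₀ (exConj c) → Sat w′ ρ₀′ (exConj c)
    exConj-transfer (k , φ , qf) short φ⊆′ sat a′ = from (Sat-∃s w′ k (a′ ∷ᶠ ρ₀′) φ) (front k ρ′ , sat′)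
      where
        φ⊆ : predicates φ ⊆ Ps
        φ⊆ = φ⊆′ ∘ subst (_ ∈_) (sym (predicates-∃s k φ))
        k+1≤V : k + 1 ≤ V
        k+1≤V = ≤-trans (≤-reflexive (+-comm k 1)) (≤-trans (s≤s (≤-trans (m≤m+n k (len φ)) (n≤1+n _)))
                                                    (≤-trans (s≤s (s≤s (len-∃s k φ))) short))
        witness = to (Sat-∃s w k (emb a′ ∷ᶠ ρ₀) φ) (sat (emb a′))
        ρ : Fin (k + 1) → Fin (size w)
        ρ = prepend k (proj₁ witness) (emb a′ ∷ᶠ ρ₀)
        lowered = lower k+1≤V ρ a′ (prepend-↑ʳ k (proj₁ witness) (emb a′ ∷ᶠ ρ₀) Fin.zero)
        ρ′ = proj₁ lowered
        ρ′≗ : ∀ i → ρ′ i ≡ prepend k (front k ρ′) (a′ ∷ᶠ ρ₀′) i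
        ρ′≗ i = trans (sym (prepend-front-back k ρ′ i)) (prepend-cong k (λ _ → refl) (λ { Fin.zero → proj₂ (proj₂ lowered) }) i)
        sat′ : Sat w′ (prepend k (front k ρ′) (a′ ∷ᶠ ρ₀′)) φ
        sat′ = sat-≗ ρ′≗ qf φ⊆ (to (qf-invariant Ps w w′ ρ ρ′ (proj₁ (proj₂ lowered)) qf φ⊆) (proj₂ witness))

    allConj-transfer : (c : AllConj s) → len (allConj c) ≤ V → predicates (allConj c) ⊆ Ps → Sat w ρ₀ (allConj c) → Sat w′ ρ₀′ (allConj c)
    allConj-transfer (l , φ , qf) short φ⊆′ sat = from (Sat-∀s w′ l ρ₀′ φ) λ σ′ →
      let (ρ , ρ≈) = lift l+0≤V (prepend l σ′ ρ₀′)
          ρ≗ i = trans (prepend-cong l (λ _ → refl) (λ ()) i) (prepend-front-back l ρ i)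
      in to (qf-invariant Ps w w′ ρ _ ρ≈ qf φ⊆) (sat-≗ ρ≗ qf φ⊆ (to (Sat-∀s w l ρ₀ φ) sat (front l ρ)))
      where
        φ⊆ : predicates φ ⊆ Ps
        φ⊆ = φ⊆′ ∘ subst (_ ∈_) (sym (predicates-∀s l φ))
        l+0≤V : l + 0 ≤ V
        l+0≤V = ≤-trans (+-monoʳ-≤ l z≤n) (≤-trans (len-∀s l φ) short)

    conjuncts-transfer : ∀ {C : Set} (f : C → Formula s 0) →
                         (∀ c → len (f c) ≤ V → predicates (f c) ⊆ Ps → Sat w ρ₀ (f c) → Sat w′ ρ₀′ (f c)) →
                         ∀ cs → len (⋀ (map f cs)) ≤ V → predicates (⋀ (map f cs)) ⊆ Ps →
                         Sat w ρ₀ (⋀ (map f cs)) → Sat w′ ρ₀′ (⋀ (map f cs))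
    conjuncts-transfer f transfer cs short ⊆Ps sat =
      from (Sat-⋀ w′ ρ₀′ (map f cs)) (go cs (∈-map⁺ f) (to (Sat-⋀ w ρ₀ (map f cs)) sat))
      where
        go : ∀ ds → (∀ {d} → d ∈ ds → f d ∈ map f cs) → All (Sat w ρ₀) (map f ds) → All (Sat w′ ρ₀′) (map f ds)
        go []       _   []           = []
        go (d ∷ ds) ∈cs (sat ∷ sats) =
          transfer d (≤-trans (len-∈-⋀ (map f cs) (∈cs (here refl))) short) (⊆Ps ∘ predicates-∈-⋀ (map f cs) (∈cs (here refl))) sat
          ∷ go ds (∈cs ∘ there) sats

  normalForm-transfer : (ψ : NormalForm s) → len ⌜ ψ ⌝ ≤ V → predicates ⌜ ψ ⌝ ⊆ Ps → w ⊨ ⌜ ψ ⌝ → w′ ⊨ ⌜ ψ ⌝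
  normalForm-transfer (nf es as) short ⊆Ps (sat∃ , sat∀) =
    conjuncts-transfer _ _ exConj (exConj-transfer _ _) es (≤-trans (m≤n⇒m≤1+n (m≤m+n _ _)) short) (⊆Ps ∘ ∈-++⁺ˡ) sat∃ ,
    conjuncts-transfer _ _ allConj (allConj-transfer _ _) as (≤-trans (m≤n⇒m≤1+n (m≤n+m _ _)) short)
      (⊆Ps ∘ ∈-++⁺ʳ (predicates (⋀ (map exConj es)))) sat∀

module _ {V n : ℕ} (n≤V : n ≤ V) where

  asTuple : ∀ {N} → (Fin n → Fin N) → Tuple V
  asTuple ρ x with toℕ x <? n
  ... | yes x<n = just (toℕ (ρ (fromℕ< x<n)))
  ... | no _    = nothing

  asTuple-inject≤ : ∀ {N} (ρ : Fin n → Fin N) y → asTuple ρ (inject≤ y n≤V) ≡ just (toℕ (ρ y))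
  asTuple-inject≤ ρ y with toℕ (inject≤ y n≤V) <? n
  ... | yes y<n = cong (λ j → just (toℕ (ρ j)))
                       (trans (Fin.fromℕ<-cong _ _ (Fin.toℕ-inject≤ y n≤V) y<n (Fin.toℕ<n y)) (Fin.fromℕ<-toℕ y (Fin.toℕ<n y)))
  ... | no y≮n  = contradiction (subst (_< n) (sym (Fin.toℕ-inject≤ y n≤V)) (Fin.toℕ<n y)) y≮n

  asTuple-within : ∀ {N} (ρ : Fin n → Fin N) → Within 0 N (asTuple ρ)
  asTuple-within ρ x with toℕ x <? n
  ... | yes _ = z≤n , Fin.toℕ<n _
  ... | no _  = tt

  module FromImage {t} {lab lab′ : ℕ → Vec Bool t} {N N′ : ℕ} (ρ : Fin n → Fin N) (I : Image lab lab′ (asTuple ρ) 0 N′) where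

    private
      read : ∀ y → Σ ℕ λ q → Image.tuple I (inject≤ y n≤V) ≡ just q × (0 ≤ q × q < N′) × lab (toℕ (ρ y)) ≡ lab′ q
      read y = image-just I (asTuple-inject≤ ρ y)

    ρ′ : Fin n → Fin N′
    ρ′ y = fromℕ< (proj₂ (proj₁ (proj₂ (proj₂ (read y)))))

    tuple-inject≤ : ∀ y → Image.tuple I (inject≤ y n≤V) ≡ just (toℕ (ρ′ y))
    tuple-inject≤ y = trans (proj₁ (proj₂ (read y))) (cong just (sym (Fin.toℕ-fromℕ< _)))

    pairTypes : ∀ x y → pairType lab (just (toℕ (ρ x))) (just (toℕ (ρ y))) ≡ pairType lab′ (just (toℕ (ρ′ x))) (just (toℕ (ρ′ y)))
    pairTypes x y = pairType-≡ (sym (asTuple-inject≤ ρ x)) (sym (asTuple-inject≤ ρ y)) (sym (tuple-inject≤ x)) (sym (tuple-inject≤ y))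
                      (Image.sameType I (inject≤ x n≤V) (inject≤ y n≤V))

module Shorten {s} (Ps : List (Fin s)) (V : ℕ) (w : Word s) (cut : Cut V (labelling w Ps) (size w)) where

  open Excision V (labelling w Ps) (size w) cut

  emb : Fin N′ → Fin (size w)
  emb q = fromℕ< (embed<N (Fin.toℕ<n q))

  w′ : Word s
  w′ = record { size     = N′
              ; nonempty = ≤-trans (s≤s z≤n) (≤-trans (m≤n+m (suc V) b₁) c₁≤N′)
              ; label    = label w ∘ emb }
    where open Cut cut using (b₁)

  labelling-w′ : ∀ q → labelling w′ Ps (toℕ q) ≡ lab′ (toℕ q)
  labelling-w′ q = begin
    labelling w′ Ps (toℕ q)           ≡⟨ labelling-toℕ w′ Ps q ⟩
    letters (label w (emb q)) Ps      ≡⟨ labelling-toℕ w Ps (emb q) ⟨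
    labelling w Ps (toℕ (emb q))      ≡⟨ cong (labelling w Ps) (Fin.toℕ-fromℕ< _) ⟩
    lab′ (toℕ q)                      ∎
    where open ≡-Reasoning

  liftAssignment : ∀ {n} → n ≤ V → (ρ′ : Fin n → Fin N′) → Σ (Fin n → Fin (size w)) λ ρ → Indistinguishable Ps w ρ w′ ρ′
  liftAssignment n≤V ρ′ = ρ , λ x y → sym (trans (pairType-label (labelling w′ Ps) lab′ (just (toℕ (ρ′ y))) (labelling-w′ (ρ′ x)))
                                                  (pairTypes x y))
    where open FromImage n≤V ρ′ (lift (asTuple n≤V ρ′) (asTuple-within n≤V ρ′)) renaming (ρ′ to ρ)

  lowerAssignment : ∀ {n} → n ≤ V → (ρ : Fin n → Fin (size w)) {x₀ : Fin n} (a′ : Fin N′) → ρ x₀ ≡ emb a′ →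
                    Σ (Fin n → Fin N′) λ ρ′ → Indistinguishable Ps w ρ w′ ρ′ × ρ′ x₀ ≡ a′
  lowerAssignment n≤V ρ {x₀} a′ ρx₀≡ =
    ρ′ , (λ x y → trans (pairTypes x y) (sym (pairType-label (labelling w′ Ps) lab′ (just (toℕ (ρ′ y))) (labelling-w′ (ρ′ x))))) ,
    Fin.toℕ-injective (just-injective (trans (sym (tuple-inject≤ x₀)) (proj₂ lowered)))
    where
      lowered = lower (asTuple n≤V ρ) (asTuple-within n≤V ρ) {inject≤ x₀ n≤V} (toℕ a′)
                  (trans (asTuple-inject≤ n≤V ρ x₀) (cong just (trans (cong toℕ ρx₀≡) (Fin.toℕ-fromℕ< _))))
      open FromImage n≤V ρ (proj₁ lowered)

  shorter : N′ < size w
  shorter = N′<N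

  preserves : (ψ : NormalForm s) → len ⌜ ψ ⌝ ≤ V → predicates ⌜ ψ ⌝ ⊆ Ps → w ⊨ ⌜ ψ ⌝ → w′ ⊨ ⌜ ψ ⌝
  preserves = Transfer.normalForm-transfer Ps V w w′ emb liftAssignment lowerAssignment

2^[1+n]≡2^n+2^n : ∀ n → 2 ^ suc n ≡ 2 ^ n + 2 ^ n
2^[1+n]≡2^n+2^n n = cong (2 ^ n +_) (+-identityʳ (2 ^ n))

1+x≤x+x : ∀ {x} → 1 ≤ x → suc x ≤ x + x
1+x≤x+x {x} 1≤x = subst (_≤ x + x) (+-comm x 1) (+-monoʳ-≤ x 1≤x)

n<2^n : ∀ n → n < 2 ^ n
n<2^n zero    = s≤s z≤n
n<2^n (suc n) = ≤-trans (s≤s (n<2^n n)) (subst (suc (2 ^ n) ≤_) (sym (2^[1+n]≡2^n+2^n n)) (1+x≤x+x (m^n>0 2 n)))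

2^a+2^b≤2^[1+a+b] : ∀ a b → 2 ^ a + 2 ^ b ≤ 2 ^ suc (a + b)
2^a+2^b≤2^[1+a+b] a b = subst (2 ^ a + 2 ^ b ≤_) (sym (2^[1+n]≡2^n+2^n (a + b)))
                          (+-mono-≤ (^-monoʳ-≤ 2 (m≤m+n a b)) (^-monoʳ-≤ 2 (m≤n+m b a)))

1+2^a+2^a≤2^[2+a] : ∀ a → suc (2 ^ a + 2 ^ a) ≤ 2 ^ (2 + a)
1+2^a+2^a≤2^[2+a] a = subst (suc (2 ^ a + 2 ^ a) ≤_) (sym (trans (2^[1+n]≡2^n+2^n (suc a)) (cong₂ _+_ (2^[1+n]≡2^n+2^n a) (2^[1+n]≡2^n+2^n a))))
                        (1+x≤x+x (≤-trans (m^n>0 2 a) (m≤m+n _ _)))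

exponent : ℕ → ℕ → ℕ
exponent t V = (2 + (5 + t) * V * V) + suc (t * suc (V + suc V) + (suc V + suc V))

cutThreshold≤2^exponent : ∀ t V → cutThreshold t V ≤ 2 ^ exponent t V
cutThreshold≤2^exponent t V =
  subst (cutThreshold t V ≤_) (sym (^-distribˡ-+-* 2 (2 + (5 + t) * V * V) _)) (*-mono-≤ 1+2M≤ D≤)
  where
    M≡ : #typeMatrices V t ≡ 2 ^ ((5 + t) * V * V)
    M≡ = trans (cong (_^ V) (^-*-assoc 2 (5 + t) V)) (^-*-assoc 2 ((5 + t) * V) V)
    1+2M≤ : suc (#typeMatrices V t + #typeMatrices V t) ≤ 2 ^ (2 + (5 + t) * V * V)
    1+2M≤ rewrite M≡ = 1+2^a+2^a≤2^[2+a] ((5 + t) * V * V)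
    #windows≡ : #windows t V ≡ 2 ^ (t * suc (V + suc V))
    #windows≡ = trans (length-vectors (vectors bools t) _) (trans (cong (_^ suc (V + suc V)) (length-vectors bools t)) (^-*-assoc 2 t _))
    D≤ : blockLength t V ≤ 2 ^ suc (t * suc (V + suc V) + (suc V + suc V))
    D≤ = ≤-trans (+-mono-≤ (≤-reflexive #windows≡) (<⇒≤ (n<2^n (suc V + suc V)))) (2^a+2^b≤2^[1+a+b] (t * suc (V + suc V)) (suc V + suc V))

exponent-monoˡ : ∀ {t V} → t ≤ V → exponent t V ≤ exponent V V
exponent-monoˡ {t} {V} t≤V = +-mono-≤ (+-monoʳ-≤ 2 (*-monoˡ-≤ V (*-monoˡ-≤ V (+-monoʳ-≤ 5 t≤V))))
                                       (s≤s (+-monoˡ-≤ (suc V + suc V) (*-monoˡ-≤ (suc (V + suc V)) t≤V)))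

bound : Poly
bound = 5 ∷ 4 ∷ 7 ∷ 1 ∷ []

exponent≡bound : ∀ n → exponent n n ≡ eval bound n
exponent≡bound = unfolded
  where
    unfolded : ∀ n → (2 + (5 + n) * n * n) + suc (n * suc (n + suc n) + (suc n + suc n)) ≡ 5 + n * (4 + n * (7 + n * (1 + n * 0)))
    unfolded = solve-∀

-- At concrete lengths pass t and V explicitly: otherwise unification unfolds
-- the arithmetic inside 2 ^ eval bound V.
cutThreshold≤2^bound-at : ∀ {t V} → t ≤ V → cutThreshold t V ≤ 2 ^ eval bound V
cutThreshold≤2^bound-at {t} {V} t≤V = ≤-trans (cutThreshold≤2^exponent t V)
  (^-monoʳ-≤ 2 (≤-trans (exponent-monoˡ t≤V) (≤-reflexive (exponent≡bound V))))

shrink : ∀ {s} (φ : Formula s 0) (B : ℕ) →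
         (∀ w → w ⊨ φ → B ≤ size w → Σ (Word s) λ w′ → w′ ⊨ φ × size w′ < size w) →
         ∀ w → w ⊨ φ → Σ (Word s) λ w′ → w′ ⊨ φ × size w′ ≤ B
shrink {s} φ B step w = go w (<-wellFounded (size w))
  where
    go : ∀ w → Acc _<_ (size w) → w ⊨ φ → Σ (Word s) λ w′ → w′ ⊨ φ × size w′ ≤ B
    go w (acc smaller) sat with size w ≤? B
    ... | yes small = w , sat , small
    ... | no big with w′ , sat′ , shorter ← step w sat (<⇒≤ (≰⇒> big)) = go w′ (smaller shorter) sat′

module _ {s} (ψ : NormalForm s) where

  cutStep : ∀ w → w ⊨ ⌜ ψ ⌝ → cutThreshold (length (predicates ⌜ ψ ⌝)) (len ⌜ ψ ⌝) ≤ size w →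
            Σ (Word s) λ w′ → w′ ⊨ ⌜ ψ ⌝ × size w′ < size w
  cutStep w sat long = w′ , preserves ψ ≤-refl id sat , shorter
    where open Shorten (predicates ⌜ ψ ⌝) (len ⌜ ψ ⌝) w (FindCut.cut (len ⌜ ψ ⌝) (labelling w (predicates ⌜ ψ ⌝)) (size w) long)

lemma4p5 : Σ Poly λ p → (s : ℕ) (ψ : NormalForm s) → Σ (Word s) (λ w → w ⊨ ⌜ ψ ⌝) → Σ (Word s) λ w → (w ⊨ ⌜ ψ ⌝) × (size w ≤ 2 ^ eval p (len ⌜ ψ ⌝))
lemma4p5 = bound , λ s ψ (w , sat) →
  let (w′ , sat′ , small) = shrink ⌜ ψ ⌝ _ (cutStep ψ) w sat
  in w′ , sat′ , ≤-trans small (cutThreshold≤2^bound-at {length (predicates ⌜ ψ ⌝)} {len ⌜ ψ ⌝} (length-predicates ⌜ ψ ⌝))
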